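{- Let $\ell$ be a positive integer. The bivariate generating function $D[\ell](z,w)=\sum_{n,m\ge0}D[\ell]_{n,m}z^nw^m$ satisfies $$D[\ell](z,w)=1+wzD[\ell]^2+wz^{1+\ell}D[\ell]^{2+\ell}+wz^{1+2\ell}D[\ell]^{2+2\ell}+\cdots=1+\frac{wzD[\ell]^2}{1-z^\ell D[\ell]^\ell}.$$
   Context: A dissection of a convex polygon with labelled vertices is a set of pairwise non-crossing diagonals, partitioning the polygon into sub-polygons (cells). For a positive integer $\ell$, a dissection is $\ell$-periodic if each cell has $3+\ell d$ vertices for some integer $d\ge0$. For $n\ge1$, $D[\ell]_{n,m}$ is the number of $\ell$-periodic dissections of a fixed convex $(n+2)$-gon with exactly $m$ cells; $D[\ell]_{0,0}=1$ and $D[\ell]_{0,m}=0$ for $m>0$. -}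

module Defs where

open import Data.Nat using (ℕ; zero; suc; _+_; _*_; _∸_; _≡ᵇ_; _≤ᵇ_; _<ᵇ_)
open import Data.Bool using (Bool; true; false; _∧_; _∨_; not; if_then_else_)
open import Data.List using (List; []; _∷_; [_]; _++_; map; concatMap; length; filterᵇ; upTo)
open import Data.Bool.ListAction using (all; any)
open import Data.Product using (_×_; _,_)
open import Relation.Binary.PropositionalEquality using (_≡_)

-- Bivariate formal power series in z, w with ℕ coefficients:
-- F n m is the coefficient of z^n w^m.

PS : Set
PS = ℕ → ℕ → ℕ

sumTo : ℕ → (ℕ → ℕ) → ℕ
sumTo zero    f = f 0
sumTo (suc n) f = sumTo n f + f (suc n)

oneₚ : PS
oneₚ zero zero = 1
oneₚ _    _    = 0

mono : ℕ → ℕ → PS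
mono a b n m = if (n ≡ᵇ a) ∧ (m ≡ᵇ b) then 1 else 0

infixl 6 _⊕_ _⊖_
infixl 7 _⊛_
infixr 8 _^ₚ_

_⊕_ : PS → PS → PS
(f ⊕ g) n m = f n m + g n m

-- coefficientwise (truncated) subtraction; used only as D - 1,
-- where it is exact since D has constant term 1.
_⊖_ : PS → PS → PS
(f ⊖ g) n m = f n m ∸ g n m

_⊛_ : PS → PS → PS
(f ⊛ g) n m = sumTo n λ i → sumTo m λ j → f i j * g (n ∸ i) (m ∸ j)

_^ₚ_ : PS → ℕ → PS
f ^ₚ zero  = oneₚ
f ^ₚ suc k = f ⊛ (f ^ₚ k)

-- Sum Σ_{k≥0} F k of a family of series such that the coefficient of
-- z^n w^m in F k vanishes whenever k > n (every family used below has
-- this property: F k is divisible by z^(1+kℓ) with ℓ ≥ 1).  For such a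
-- family the formal infinite sum has coefficient Σ_{k=0}^{n} (F k) n m.
Σz : (ℕ → PS) → PS
Σz F n m = sumTo n λ k → F k n m

infix 4 _≈ₚ_
_≈ₚ_ : PS → PS → Set
f ≈ₚ g = ∀ n m → f n m ≡ g n m

-- Dissections of a convex polygon with vertices labelled 0,1,...,N-1
-- (in cyclic order).  A chord is a pair (i , j) with i < j.

Chord : Set
Chord = ℕ × ℕ

-- all diagonals of the convex (n+2)-gon with vertices 0..n+1:
-- pairs (i , j) with i + 2 ≤ j ≤ n+1 and (i , j) ≠ (0 , n+1)
diagonals : ℕ → List Chord
diagonals n =
  concatMap (λ i → concatMap (λ j →
      if (i + 2 ≤ᵇ j) ∧ not ((i ≡ᵇ 0) ∧ (j ≡ᵇ suc n)) then [ (i , j) ] else [])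
    (upTo (n + 2))) (upTo (n + 2))

crosses : Chord → Chord → Bool
crosses (a , b) (c , d) =
  ((a <ᵇ c) ∧ (c <ᵇ b) ∧ (b <ᵇ d)) ∨ ((c <ᵇ a) ∧ (a <ᵇ d) ∧ (d <ᵇ b))

nonCrossing : List Chord → Bool
nonCrossing S = all (λ p → all (λ q → not (crosses p q)) S) S

-- all sub-lists (= all subsets, for a duplicate-free list)
sublists : {A : Set} → List A → List (List A)
sublists []       = [ [] ]
sublists (x ∷ xs) = map (x ∷_) (sublists xs) ++ sublists xs

sameChord : Chord → Chord → Bool
sameChord (a , b) (c , d) = (a ≡ᵇ c) ∧ (b ≡ᵇ d)

-- For a non-crossing set S of diagonals of the (n+2)-gon, every cell has a
-- unique "top" side (a , b) ∈ (0 , n+1) ∷ S (the side of largest span); the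
-- cell below (a , b) has vertices a, b and those v with a < v < b that are not
-- strictly enclosed by another chord (c , d) ∈ S with a ≤ c < v < d ≤ b.
-- cellSize n S (a , b) is the number of vertices of that cell.
cellSize : ℕ → List Chord → Chord → ℕ
cellSize n S (a , b) = 2 + length (filterᵇ visible (upTo (n + 2)))
  where
  hidden : ℕ → Bool
  hidden v = any (λ { (c , d) → (a ≤ᵇ c) ∧ (c <ᵇ v) ∧ (v <ᵇ d) ∧ (d ≤ᵇ b)
                                 ∧ not (sameChord (c , d) (a , b)) }) S
  visible : ℕ → Bool
  visible v = (a <ᵇ v) ∧ (v <ᵇ b) ∧ not (hidden v)

-- the cells of the dissection S of the (n+2)-gon, indexed by their top sides
cellTops : ℕ → List Chord → List Chord
cellTops n S = (0 , suc n) ∷ S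

-- k = 3 + ℓ d for some d ≥ 0  (such d is ≤ k when it exists and ℓ ≥ 1;
-- for ℓ = 0 the bound d ≤ k is also harmless)
periodicSize : ℕ → ℕ → Bool
periodicSize ℓ k = any (λ d → k ≡ᵇ 3 + ℓ * d) (upTo (suc k))

isPeriodicDissection : ℕ → ℕ → ℕ → List Chord → Bool
isPeriodicDissection ℓ n m S =
  nonCrossing S
  ∧ (length (cellTops n S) ≡ᵇ m)
  ∧ all (λ t → periodicSize ℓ (cellSize n S t)) (cellTops n S)

Dcoef : ℕ → PS
Dcoef ℓ zero    m = if m ≡ᵇ 0 then 1 else 0
Dcoef ℓ (suc k) m =
  length (filterᵇ (isPeriodicDissection ℓ (suc k) m) (sublists (diagonals (suc k))))

Dgf : ℕ → PS
Dgf ℓ = Dcoef ℓ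

-- Cutting off the root side (0 , n+1) of a dissection leaves its root cell, with
-- 3 + d ℓ vertices 0 = v₀ < v₁ < ⋯ < v_(2+dℓ) = n+1, and below each of its other
-- 2 + d ℓ sides (vᵢ , vᵢ₊₁) an arbitrary periodic dissection of a smaller polygon;
-- this is the term w z^(1+dℓ) D^(2+dℓ).  To make the product formal, chord sets on an
-- interval [0 , k] are counted by the number r of "open" vertices, those no chord
-- passes over: cutting at the first open vertex shows that these counts factor, so
-- they are the coefficients of D^(r+1).  For the second identity the root cells with
-- three vertices give w z D², and in the others one cuts at the ℓ-th open vertex,
-- splitting off z^ℓ D^ℓ and leaving a root cell that is ℓ vertices smaller.

module Submission where

open import Defs
open import Data.Nat
  using (ℕ; zero; suc; NonZero; _≤_; _<_; _≮_; _+_; _*_; _∸_; _⊔_; _≡ᵇ_; _≤ᵇ_; _<ᵇ_; z≤n; s≤s)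
open import Data.Nat.Properties
open import Algebra.Properties.CommutativeSemigroup +-commutativeSemigroup using () renaming (interchange to +-interchange)
open import Data.Nat.DivMod using (_/_; _%_; m≡m%n+[m/n]*n; m*n%n≡0)
open import Data.Bool using (Bool; true; false; _∧_; _∨_; not; if_then_else_; T)
open import Data.Bool.Properties
  using (T-≡; T?; ∨-isCommutativeMonoid; ∧-isCommutativeMonoid; ∨-assoc; ∧-assoc; ∨-zeroʳ; ∧-zeroʳ; ∨-identityʳ; ∧-identityʳ)
open import Data.Product using (_×_; _,_; proj₁; proj₂; ∃-syntax)
open import Data.Sum using (_⊎_; inj₁; inj₂)
open import Data.Empty using (⊥; ⊥-elim)
open import Relation.Nullary using (¬_; yes; no)
open import Relation.Nullary.Decidable using (decidable-stable)
open import Relation.Binary.PropositionalEquality hiding ([_])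
open import Data.List using (List; []; _∷_; [_]; _++_; map; length; filterᵇ; upTo; applyUpTo; cartesianProduct; concatMap)
import Data.List.Relation.Unary.All as All
open import Data.List.Relation.Unary.AllPairs using (_∷_)
open import Data.List.Properties using (length-++; length-map; filter-++)
open import Data.Bool.ListAction using (all; any)
open import Data.List.Membership.Propositional using (_∈_)
open import Data.List.Relation.Unary.Any using (here; there)
open import Data.List.Relation.Binary.Subset.Propositional using (_⊆_)
open import Data.List.Relation.Binary.Subset.Propositional.Properties using (∷⁺ʳ)
open import Data.List.Relation.Unary.Unique.Propositional using (Unique)
import Data.List.Relation.Unary.Unique.Propositional.Properties as Unique
open import Data.List.Membership.Propositional.Properties
  using ( ∈-filter⁺; ∈-filter⁻; ∈-cartesianProduct⁺; ∈-cartesianProduct⁻; ∈-upTo⁺; ∈-upTo⁻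
        ; ∈-map⁺; ∈-map⁻; ∈-++⁺ˡ; ∈-++⁺ʳ; ∈-++⁻)
open import Data.List.Relation.Binary.Permutation.Propositional
  using (_↭_; prep; swap; ↭⇒↭ₛ) renaming (refl to ↭-refl; trans to ↭-trans)
open import Data.List.Relation.Binary.BagAndSetEquality using (∼bag⇒↭)
open import Data.List.Relation.Binary.Permutation.Propositional.Properties
  using (↭-length) renaming (map⁺ to ↭-map⁺)
open import Data.List.Relation.Binary.Permutation.Setoid.Properties using (foldr-commMonoid)
open import Data.List.Membership.Propositional.Properties.WithK using (unique∧set⇒bag)
open import Function.Base using (_∘_; id)
open import Function.Bundles using (_⇔_; mk⇔; Equivalence)

true≢false : true ≢ false
true≢false ()

≢true⇒≡false : ∀ {b} → b ≢ true → b ≡ false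
≢true⇒≡false {true}  h = ⊥-elim (h refl)
≢true⇒≡false {false} _ = refl

not≡true⇒≡false : ∀ {b} → not b ≡ true → b ≡ false
not≡true⇒≡false {false} _ = refl

∧≡true⁻ : ∀ {a b} → a ∧ b ≡ true → a ≡ true × b ≡ true
∧≡true⁻ {true} {true} _ = refl , refl

not∨≡true⁻ : ∀ {a b} → not (a ∨ b) ≡ true → a ≡ false × b ≡ false
not∨≡true⁻ {false} {false} _ = refl , refl

∧≡true⁺ : ∀ {a b} → a ≡ true → b ≡ true → a ∧ b ≡ true
∧≡true⁺ refl refl = refl

from-T : ∀ {b} → T b → b ≡ true
from-T = Equivalence.to T-≡

to-T : ∀ {b} → b ≡ true → T b
to-T = Equivalence.from T-≡

<ᵇ-true : ∀ {m n} → m < n → (m <ᵇ n) ≡ true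
<ᵇ-true m<n = from-T (<⇒<ᵇ m<n)

<ᵇ-false : ∀ {m n} → m ≮ n → (m <ᵇ n) ≡ false
<ᵇ-false {m} {n} m≮n = ≢true⇒≡false (λ e → m≮n (<ᵇ⇒< m n (to-T e)))

<ᵇ-true⁻ : ∀ {m n} → (m <ᵇ n) ≡ true → m < n
<ᵇ-true⁻ {m} {n} e = <ᵇ⇒< m n (to-T e)

≤ᵇ-true : ∀ {m n} → m ≤ n → (m ≤ᵇ n) ≡ true
≤ᵇ-true m≤n = from-T (≤⇒≤ᵇ m≤n)

≤ᵇ-true⁻ : ∀ {m n} → (m ≤ᵇ n) ≡ true → m ≤ n
≤ᵇ-true⁻ {m} {n} e = ≤ᵇ⇒≤ m n (to-T e)

≡ᵇ-true : ∀ {m n} → m ≡ n → (m ≡ᵇ n) ≡ true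
≡ᵇ-true {m} {n} m≡n = from-T (≡⇒≡ᵇ m n m≡n)

≡ᵇ-false : ∀ {m n} → m ≢ n → (m ≡ᵇ n) ≡ false
≡ᵇ-false {m} {n} m≢n = ≢true⇒≡false (λ e → m≢n (≡ᵇ⇒≡ m n (to-T e)))

≡ᵇ-true⁻ : ∀ {m n} → (m ≡ᵇ n) ≡ true → m ≡ n
≡ᵇ-true⁻ {m} {n} e = ≡ᵇ⇒≡ m n (to-T e)

≡ᵇ-sym : ∀ m n → (m ≡ᵇ n) ≡ (n ≡ᵇ m)
≡ᵇ-sym zero    zero    = refl
≡ᵇ-sym zero    (suc n) = refl
≡ᵇ-sym (suc m) zero    = refl
≡ᵇ-sym (suc m) (suc n) = ≡ᵇ-sym m n

suc[n∸1]≡n : ∀ {n} → 0 < n → suc (n ∸ 1) ≡ n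
suc[n∸1]≡n {suc n} _ = refl

cut-length : ∀ k i → i < k ∸ 1 → suc i + suc (k ∸ suc i ∸ 1) ≡ k
cut-length (suc k) i i<k = cong suc (trans (cong (i +_) (suc[n∸1]≡n (m<n⇒0<n∸m i<k))) (m+[n∸m]≡n (<⇒≤ i<k)))

𝟙 : Bool → ℕ
𝟙 b = if b then 1 else 0

𝟙≢0⇒≡true : ∀ {b} → 𝟙 b ≢ 0 → b ≡ true
𝟙≢0⇒≡true {true}  _ = refl
𝟙≢0⇒≡true {false} h = ⊥-elim (h refl)

𝟙-∧ : ∀ a b → 𝟙 (a ∧ b) ≡ 𝟙 a * 𝟙 b
𝟙-∧ true  b = sym (+-identityʳ _)
𝟙-∧ false b = refl

𝟙-≤1 : ∀ b → 𝟙 b ≤ 1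
𝟙-≤1 true  = ≤-refl
𝟙-≤1 false = z≤n

𝟙-*-implied : ∀ a b → (a ≡ true → b ≡ true) → 𝟙 a * 𝟙 b ≡ 𝟙 a
𝟙-*-implied true  b h rewrite h refl = refl
𝟙-*-implied false b h = refl

∑ : ℕ → (ℕ → ℕ) → ℕ
∑ zero    f = 0
∑ (suc n) f = ∑ n f + f n

sumTo≡∑ : ∀ n (f : ℕ → ℕ) → sumTo n f ≡ ∑ (suc n) f
sumTo≡∑ zero    f = refl
sumTo≡∑ (suc n) f = cong (_+ f (suc n)) (sumTo≡∑ n f)

∑-cong : ∀ n {f g : ℕ → ℕ} → (∀ i → i < n → f i ≡ g i) → ∑ n f ≡ ∑ n g
∑-cong zero    h = refl
∑-cong (suc n) h = cong₂ _+_ (∑-cong n (λ i i<n → h i (m<n⇒m<1+n i<n))) (h n ≤-refl)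

∑-ext : ∀ n {f g : ℕ → ℕ} → (∀ i → f i ≡ g i) → ∑ n f ≡ ∑ n g
∑-ext n h = ∑-cong n (λ i _ → h i)

∑-zero : ∀ n {f : ℕ → ℕ} → (∀ i → i < n → f i ≡ 0) → ∑ n f ≡ 0
∑-zero zero    h = refl
∑-zero (suc n) h = cong₂ _+_ (∑-zero n (λ i i<n → h i (m<n⇒m<1+n i<n))) (h n ≤-refl)

∑-distrib-+ : ∀ n (f g : ℕ → ℕ) → ∑ n (λ i → f i + g i) ≡ ∑ n f + ∑ n g
∑-distrib-+ zero    f g = refl
∑-distrib-+ (suc n) f g rewrite ∑-distrib-+ n f g = +-interchange (∑ n f) (∑ n g) (f n) (g n)

∑-*ˡ : ∀ n c (f : ℕ → ℕ) → ∑ n (λ i → c * f i) ≡ c * ∑ n f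
∑-*ˡ zero    c f = sym (*-zeroʳ c)
∑-*ˡ (suc n) c f rewrite ∑-*ˡ n c f = sym (*-distribˡ-+ c (∑ n f) (f n))

∑-*ʳ : ∀ n c (f : ℕ → ℕ) → ∑ n (λ i → f i * c) ≡ ∑ n f * c
∑-*ʳ n c f = trans (∑-ext n (λ i → *-comm (f i) c)) (trans (∑-*ˡ n c f) (*-comm c (∑ n f)))

∑-swap : ∀ n m (f : ℕ → ℕ → ℕ) → ∑ n (λ i → ∑ m (f i)) ≡ ∑ m (λ j → ∑ n (λ i → f i j))
∑-swap zero    m f = sym (∑-zero m {λ _ → 0} (λ _ _ → refl))
∑-swap (suc n) m f =
  trans (cong (_+ ∑ m (f n)) (∑-swap n m f)) (sym (∑-distrib-+ m (λ j → ∑ n (λ i → f i j)) (f n)))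

∑-+ : ∀ a b (f : ℕ → ℕ) → ∑ (a + b) f ≡ ∑ a f + ∑ b (λ i → f (a + i))
∑-+ a zero    f = trans (cong (λ x → ∑ x f) (+-identityʳ a)) (sym (+-identityʳ _))
∑-+ a (suc b) f = trans (cong (λ x → ∑ x f) (+-suc a b))
  (trans (cong (_+ f (a + b)) (∑-+ a b f)) (+-assoc (∑ a f) _ _))

∑-suc : ∀ n (f : ℕ → ℕ) → ∑ (suc n) f ≡ f 0 + ∑ n (λ i → f (suc i))
∑-suc n f = ∑-+ 1 n f

∑-pad : ∀ n N {f : ℕ → ℕ} → n ≤ N → (∀ i → n ≤ i → i < N → f i ≡ 0) → ∑ N f ≡ ∑ n f
∑-pad n N {f} n≤N h = begin
  ∑ N f                                 ≡⟨ cong (λ x → ∑ x f) (sym (m+[n∸m]≡n n≤N)) ⟩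
  ∑ (n + (N ∸ n)) f                     ≡⟨ ∑-+ n (N ∸ n) f ⟩
  ∑ n f + ∑ (N ∸ n) (λ i → f (n + i))   ≡⟨ cong (∑ n f +_) (∑-zero (N ∸ n) tail≡0) ⟩
  ∑ n f + 0                             ≡⟨ +-identityʳ _ ⟩
  ∑ n f                                 ∎
  where
  open ≡-Reasoning
  tail≡0 : ∀ i → i < N ∸ n → f (n + i) ≡ 0
  tail≡0 i i< = h (n + i) (m≤m+n n i) (subst (n + i <_) (m+[n∸m]≡n n≤N) (+-monoʳ-< n i<))

∑-single : ∀ n c {f : ℕ → ℕ} → c < n → (∀ i → i < n → i ≢ c → f i ≡ 0) → ∑ n f ≡ f c
∑-single (suc n) c {f} c<1+n h with c ≟ n
... | yes refl = cong (_+ f c) (∑-zero n (λ i i<n → h i (m<n⇒m<1+n i<n) (<⇒≢ i<n)))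
... | no c≢n = trans (cong₂ _+_ (∑-single n c (≤∧≢⇒< (≤-pred c<1+n) c≢n) (λ i i<n → h i (m<n⇒m<1+n i<n)))
                                (h n ≤-refl (≢-sym c≢n)))
                     (+-identityʳ _)

∑-𝟙≡ : ∀ n c (g : ℕ → ℕ) → ∑ n (λ i → 𝟙 (i ≡ᵇ c) * g i) ≡ 𝟙 (c <ᵇ n) * g c
∑-𝟙≡ n c g with c <? n
... | yes c<n = trans
  (∑-single n c {λ i → 𝟙 (i ≡ᵇ c) * g i} c<n (λ i _ i≢c → cong (λ b → 𝟙 b * g i) (≡ᵇ-false {i} i≢c)))
                      (trans (cong (λ b → 𝟙 b * g c) (≡ᵇ-true {c} refl)) (cong (λ b → 𝟙 b * g c) (sym (<ᵇ-true c<n))))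
... | no c≮n = trans
  (∑-zero n {λ i → 𝟙 (i ≡ᵇ c) * g i} (λ i i<n → cong (λ b → 𝟙 b * g i) (≡ᵇ-false {i} (λ { refl → c≮n i<n }))))
                     (cong (λ b → 𝟙 b * g c) (sym (<ᵇ-false c≮n)))

∑-≥ : ∀ n (g : ℕ → ℕ) i → i < n → g i ≤ ∑ n g
∑-≥ (suc n) g i i< with i ≟ n
... | yes refl = m≤n+m (g i) (∑ i g)
... | no i≢n = ≤-trans (∑-≥ n g i (≤∧≢⇒< (≤-pred i<) i≢n)) (m≤m+n (∑ n g) (g n))

∑⊆ : {A : Set} → (List A → ℕ) → List A → ℕ
∑⊆ w []       = w []
∑⊆ w (x ∷ xs) = ∑⊆ (λ T → w (x ∷ T)) xs + ∑⊆ w xs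

PermutationInvariant : {A : Set} → (List A → ℕ) → Set
PermutationInvariant w = ∀ {S S'} → S ↭ S' → w S ≡ w S'

module _ {A : Set} where

  length-filter-map : (P : List A → Bool) (f : List A → List A) (X : List (List A)) →
    length (filterᵇ P (map f X)) ≡ length (filterᵇ (P ∘ f) X)
  length-filter-map P f []      = refl
  length-filter-map P f (x ∷ X) with P (f x)
  ... | true  = cong suc (length-filter-map P f X)
  ... | false = length-filter-map P f X

  length-filter-++ : (P : List A → Bool) (X Y : List (List A)) →
    length (filterᵇ P (X ++ Y)) ≡ length (filterᵇ P X) + length (filterᵇ P Y)
  length-filter-++ P X Y = trans (cong length (filter-++ (T? ∘ P) X Y)) (length-++ (filterᵇ P X))

  count-sublists : (P : List A → Bool) (L : List A) →
    length (filterᵇ P (sublists L)) ≡ ∑⊆ (𝟙 ∘ P) L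
  count-sublists P [] with P []
  ... | true  = refl
  ... | false = refl
  count-sublists P (x ∷ L) =
    trans (length-filter-++ P (map (x ∷_) (sublists L)) (sublists L))
          (cong₂ _+_ (trans (length-filter-map P (x ∷_) (sublists L)) (count-sublists (λ T → P (x ∷ T)) L))
                     (count-sublists P L))

  ∑⊆-cong : ∀ (w w' : List A → ℕ) L → (∀ T → T ⊆ L → w T ≡ w' T) → ∑⊆ w L ≡ ∑⊆ w' L
  ∑⊆-cong w w' []      h = h [] (λ ())
  ∑⊆-cong w w' (x ∷ L) h =
    cong₂ _+_ (∑⊆-cong _ _ L (λ T T⊆L → h (x ∷ T) (∷⁺ʳ x T⊆L)))
              (∑⊆-cong _ _ L (λ T T⊆L → h T (there ∘ T⊆L)))

  ∑⊆-ext : ∀ (w w' : List A → ℕ) L → (∀ T → w T ≡ w' T) → ∑⊆ w L ≡ ∑⊆ w' L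
  ∑⊆-ext w w' L h = ∑⊆-cong w w' L (λ T _ → h T)

  ∑⊆-zero : ∀ (w : List A → ℕ) L → (∀ T → T ⊆ L → w T ≡ 0) → ∑⊆ w L ≡ 0
  ∑⊆-zero w []      h = h [] (λ ())
  ∑⊆-zero w (x ∷ L) h =
    cong₂ _+_ (∑⊆-zero _ L (λ T T⊆L → h (x ∷ T) (∷⁺ʳ x T⊆L)))
              (∑⊆-zero _ L (λ T T⊆L → h T (there ∘ T⊆L)))

  ∑⊆-distrib-+ : ∀ (w w' : List A → ℕ) L → ∑⊆ (λ T → w T + w' T) L ≡ ∑⊆ w L + ∑⊆ w' L
  ∑⊆-distrib-+ w w' []      = refl
  ∑⊆-distrib-+ w w' (x ∷ L)
    rewrite ∑⊆-distrib-+ (λ T → w (x ∷ T)) (λ T → w' (x ∷ T)) L | ∑⊆-distrib-+ w w' L =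
    +-interchange (∑⊆ (λ T → w (x ∷ T)) L) (∑⊆ (λ T → w' (x ∷ T)) L) (∑⊆ w L) (∑⊆ w' L)

  ∑⊆-*ˡ : ∀ c (w : List A → ℕ) L → ∑⊆ (λ T → c * w T) L ≡ c * ∑⊆ w L
  ∑⊆-*ˡ c w []      = refl
  ∑⊆-*ˡ c w (x ∷ L) rewrite ∑⊆-*ˡ c (λ T → w (x ∷ T)) L | ∑⊆-*ˡ c w L =
    sym (*-distribˡ-+ c (∑⊆ (λ T → w (x ∷ T)) L) (∑⊆ w L))

  ∑⊆-*ʳ : ∀ c (w : List A → ℕ) L → ∑⊆ (λ T → w T * c) L ≡ ∑⊆ w L * c
  ∑⊆-*ʳ c w L = trans (∑⊆-ext _ _ L (λ T → *-comm (w T) c)) (trans (∑⊆-*ˡ c w L) (*-comm c (∑⊆ w L)))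

  ∑⊆-∑ : ∀ n (f : ℕ → List A → ℕ) L → ∑⊆ (λ T → ∑ n (λ j → f j T)) L ≡ ∑ n (λ j → ∑⊆ (f j) L)
  ∑⊆-∑ zero    f L = ∑⊆-zero _ L (λ _ _ → refl)
  ∑⊆-∑ (suc n) f L =
    trans (∑⊆-distrib-+ (λ T → ∑ n (λ j → f j T)) (f n) L) (cong (_+ ∑⊆ (f n) L) (∑⊆-∑ n f L))

  ∑⊆-++ : ∀ (w : List A → ℕ) X Y → ∑⊆ w (X ++ Y) ≡ ∑⊆ (λ T₁ → ∑⊆ (λ T₂ → w (T₁ ++ T₂)) Y) X
  ∑⊆-++ w []      Y = refl
  ∑⊆-++ w (x ∷ X) Y = cong₂ _+_ (∑⊆-++ (λ T → w (x ∷ T)) X Y) (∑⊆-++ w X Y)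

  ∑⊆-filter : ∀ (p : A → Bool) (w : List A → ℕ) L →
    (∀ T → T ⊆ L → any (not ∘ p) T ≡ true → w T ≡ 0) → ∑⊆ w L ≡ ∑⊆ w (filterᵇ p L)
  ∑⊆-filter p w []      h = refl
  ∑⊆-filter p w (x ∷ L) h with p x in px
  ... | true  = cong₂ _+_
    (∑⊆-filter p _ L (λ T T⊆L e → h (x ∷ T) (∷⁺ʳ x T⊆L) (trans (cong (λ b → not b ∨ any (not ∘ p) T) px) e)))
    (∑⊆-filter p w L (λ T T⊆L → h T (there ∘ T⊆L)))
  ... | false = trans
    (cong (_+ ∑⊆ w L) (∑⊆-zero _ L (λ T T⊆L → h (x ∷ T) (∷⁺ʳ x T⊆L) (cong (λ b → not b ∨ any (not ∘ p) T) px))))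
    (∑⊆-filter p w L (λ T T⊆L → h T (there ∘ T⊆L)))

  ∑⊆-map : {B : Set} (f : B → A) (w : List A → ℕ) (L : List B) → ∑⊆ w (map f L) ≡ ∑⊆ (w ∘ map f) L
  ∑⊆-map f w []      = refl
  ∑⊆-map f w (x ∷ L) = cong₂ _+_ (∑⊆-map f _ L) (∑⊆-map f w L)

  ∑⊆-↭ : ∀ (w : List A → ℕ) → PermutationInvariant w → ∀ {L L'} → L ↭ L' → ∑⊆ w L ≡ ∑⊆ w L'
  ∑⊆-↭ w w-inv ↭-refl = refl
  ∑⊆-↭ w w-inv (prep x p) = cong₂ _+_ (∑⊆-↭ _ (w-inv ∘ prep x) p) (∑⊆-↭ w w-inv p)
  ∑⊆-↭ w w-inv {x ∷ y ∷ xs} {.y ∷ .x ∷ ys} (swap x y p) = begin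
      (∑⊆ (λ T → w (x ∷ y ∷ T)) xs + ∑⊆ (λ T → w (x ∷ T)) xs) + (∑⊆ (λ T → w (y ∷ T)) xs + ∑⊆ w xs)
    ≡⟨ cong₂ _+_ (cong₂ _+_ xy (∑⊆-↭ _ (w-inv ∘ prep x) p))
                 (cong₂ _+_ (∑⊆-↭ _ (w-inv ∘ prep y) p) (∑⊆-↭ w w-inv p)) ⟩
      (∑⊆ (λ T → w (y ∷ x ∷ T)) ys + ∑⊆ (λ T → w (x ∷ T)) ys) + (∑⊆ (λ T → w (y ∷ T)) ys + ∑⊆ w ys)
    ≡⟨ +-interchange (∑⊆ (λ T → w (y ∷ x ∷ T)) ys) _ _ _ ⟩
      (∑⊆ (λ T → w (y ∷ x ∷ T)) ys + ∑⊆ (λ T → w (y ∷ T)) ys) + (∑⊆ (λ T → w (x ∷ T)) ys + ∑⊆ w ys)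
    ∎
    where
    open ≡-Reasoning
    xy : ∑⊆ (λ T → w (x ∷ y ∷ T)) xs ≡ ∑⊆ (λ T → w (y ∷ x ∷ T)) ys
    xy = trans (∑⊆-↭ _ (w-inv ∘ prep x ∘ prep y) p) (∑⊆-ext _ _ ys (λ T → w-inv (swap x y ↭-refl)))
  ∑⊆-↭ w w-inv (↭-trans p q) = trans (∑⊆-↭ w w-inv p) (∑⊆-↭ w w-inv q)

  ∑⊆-sameSet : ∀ (w : List A → ℕ) → PermutationInvariant w → ∀ {L L'} → Unique L → Unique L' →
    (∀ {x} → x ∈ L ⇔ x ∈ L') → ∑⊆ w L ≡ ∑⊆ w L'
  ∑⊆-sameSet w w-inv uL uL' L≈L' = ∑⊆-↭ w w-inv (∼bag⇒↭ (unique∧set⇒bag uL uL' L≈L'))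

module _ {A : Set} where

  any-++ : (f : A → Bool) (xs ys : List A) → any f (xs ++ ys) ≡ any f xs ∨ any f ys
  any-++ f []       ys = refl
  any-++ f (x ∷ xs) ys rewrite any-++ f xs ys = sym (∨-assoc (f x) (any f xs) (any f ys))

  all-++ : (f : A → Bool) (xs ys : List A) → all f (xs ++ ys) ≡ all f xs ∧ all f ys
  all-++ f []       ys = refl
  all-++ f (x ∷ xs) ys rewrite all-++ f xs ys = sym (∧-assoc (f x) (all f xs) (all f ys))

  any-cong : (f g : A → Bool) (xs : List A) → (∀ x → x ∈ xs → f x ≡ g x) → any f xs ≡ any g xs
  any-cong f g []       h = refl
  any-cong f g (x ∷ xs) h = cong₂ _∨_ (h x (here refl)) (any-cong f g xs (λ y m → h y (there m)))

  all-cong : (f g : A → Bool) (xs : List A) → (∀ x → x ∈ xs → f x ≡ g x) → all f xs ≡ all g xs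
  all-cong f g []       h = refl
  all-cong f g (x ∷ xs) h = cong₂ _∧_ (h x (here refl)) (all-cong f g xs (λ y m → h y (there m)))

  any-false : (f : A → Bool) (xs : List A) → (∀ x → x ∈ xs → f x ≡ false) → any f xs ≡ false
  any-false f []       h = refl
  any-false f (x ∷ xs) h rewrite h x (here refl) = any-false f xs (λ y m → h y (there m))

  all-true : (f : A → Bool) (xs : List A) → (∀ x → x ∈ xs → f x ≡ true) → all f xs ≡ true
  all-true f []       h = refl
  all-true f (x ∷ xs) h rewrite h x (here refl) = all-true f xs (λ y m → h y (there m))

  any-true : (f : A → Bool) {x : A} (xs : List A) → x ∈ xs → f x ≡ true → any f xs ≡ true
  any-true f (y ∷ xs) (here refl) e rewrite e = refl
  any-true f (y ∷ xs) (there m)   e rewrite any-true f xs m e = ∨-zeroʳ (f y)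

  any-true⁻ : (f : A → Bool) (xs : List A) → any f xs ≡ true → ∃[ x ] (x ∈ xs × f x ≡ true)
  any-true⁻ f (x ∷ xs) e with f x in fx
  ... | true  = x , here refl , fx
  ... | false with any-true⁻ f xs e
  ...   | y , m , fy = y , there m , fy

  all-true⁻ : (f : A → Bool) (xs : List A) → all f xs ≡ true → ∀ x → x ∈ xs → f x ≡ true
  all-true⁻ f (y ∷ xs) e x (here refl) = proj₁ (∧≡true⁻ e)
  all-true⁻ f (y ∷ xs) e x (there m)   = all-true⁻ f xs (proj₂ (∧≡true⁻ {f y} e)) x m

  any-↭ : (f : A → Bool) {xs ys : List A} → xs ↭ ys → any f xs ≡ any f ys
  any-↭ f p = foldr-commMonoid (setoid Bool) ∨-isCommutativeMonoid (↭⇒↭ₛ (↭-map⁺ f p))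

  all-↭ : (f : A → Bool) {xs ys : List A} → xs ↭ ys → all f xs ≡ all f ys
  all-↭ f p = foldr-commMonoid (setoid Bool) ∧-isCommutativeMonoid (↭⇒↭ₛ (↭-map⁺ f p))

  module _ {B : Set} where

    all-map : (f : B → Bool) (g : A → B) (xs : List A) → all f (map g xs) ≡ all (f ∘ g) xs
    all-map f g []       = refl
    all-map f g (x ∷ xs) = cong (f (g x) ∧_) (all-map f g xs)

    any-map : (f : B → Bool) (g : A → B) (xs : List A) → any f (map g xs) ≡ any (f ∘ g) xs
    any-map f g []       = refl
    any-map f g (x ∷ xs) = cong (f (g x) ∨_) (any-map f g xs)

count : (ℕ → Bool) → ℕ → ℕ → ℕ
count f a n = ∑ n (λ i → 𝟙 (f (a + i)))

count-cong : ∀ (f g : ℕ → Bool) a n → (∀ i → i < n → f (a + i) ≡ g (a + i)) → count f a n ≡ count g a n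
count-cong f g a n h = ∑-cong n (λ i i<n → cong 𝟙 (h i i<n))

count-ext : ∀ (f g : ℕ → Bool) a n → (∀ u → f u ≡ g u) → count f a n ≡ count g a n
count-ext f g a n h = count-cong f g a n (λ i _ → h (a + i))

count≤ : ∀ f a n → count f a n ≤ n
count≤ f a zero    = z≤n
count≤ f a (suc n) =
  subst (count f a n + 𝟙 (f (a + n)) ≤_) (+-comm n 1) (+-mono-≤ (count≤ f a n) (𝟙-≤1 (f (a + n))))

count-shift : ∀ (f : ℕ → Bool) t a n → count f (t + a) n ≡ count (λ u → f (t + u)) a n
count-shift f t a n = ∑-ext n (λ i → cong (𝟙 ∘ f) (+-assoc t a i))

count-rank : ∀ (f : ℕ → Bool) a r n →
  ∑ n (λ i → 𝟙 (f (a + i) ∧ (count f a i ≡ᵇ r))) ≡ 𝟙 (r <ᵇ count f a n)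
count-rank f a r zero = refl
count-rank f a r (suc n) rewrite count-rank f a r n with f (a + n)
... | false = trans (+-identityʳ _) (cong (λ x → 𝟙 (r <ᵇ x)) (sym (+-identityʳ (count f a n))))
... | true  = step r (count f a n)
  where
  step : ∀ r c → 𝟙 (r <ᵇ c) + 𝟙 (c ≡ᵇ r) ≡ 𝟙 (r <ᵇ c + 1)
  step zero    zero    = refl
  step zero    (suc c) = refl
  step (suc r) zero    = refl
  step (suc r) (suc c) = step r c

-- Chords over an interval of vertices

covers : ℕ → ℕ → ℕ → Chord → Bool
covers a b v (c , d) = (a ≤ᵇ c) ∧ (c <ᵇ v) ∧ (v <ᵇ d) ∧ (d ≤ᵇ b)

-- literally the predicate hidden of cellSize, so that the two agree by computation
hides : ℕ → ℕ → ℕ → Chord → Bool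
hides a b v (c , d) = (a ≤ᵇ c) ∧ (c <ᵇ v) ∧ (v <ᵇ d) ∧ (d ≤ᵇ b) ∧ not (sameChord (c , d) (a , b))

cellInnerSize : List Chord → Chord → ℕ
cellInnerSize S (a , b) = count (λ v → not (any (hides a b v) S)) (suc a) (b ∸ a ∸ 1)

isOpen : List Chord → ℕ → ℕ → ℕ → Bool
isOpen S c d v = not (any (covers c d v) S)

openCount : List Chord → ℕ → ℕ → ℕ
openCount S c d = count (isOpen S c d) (suc c) (d ∸ c ∸ 1)

isChordIn : ℕ → ℕ → Chord → Bool
isChordIn c d (x , y) = (c ≤ᵇ x) ∧ (suc (suc x) ≤ᵇ y) ∧ (y ≤ᵇ d)

chordsIn : ℕ → ℕ → List Chord
chordsIn c k = filterᵇ (isChordIn c (c + k)) (cartesianProduct (upTo (suc (c + k))) (upTo (suc (c + k))))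

covers⁻ : ∀ {a b v c d} → covers a b v (c , d) ≡ true → a ≤ c × c < v × v < d × d ≤ b
covers⁻ {a} e with ∧≡true⁻ {a ≤ᵇ _} e
... | e₁ , e₂ with ∧≡true⁻ e₂
... | e₃ , e₄ with ∧≡true⁻ e₄
... | e₅ , e₆ = ≤ᵇ-true⁻ e₁ , <ᵇ-true⁻ e₃ , <ᵇ-true⁻ e₅ , ≤ᵇ-true⁻ e₆

covers⁺ : ∀ {a b v c d} → a ≤ c → c < v → v < d → d ≤ b → covers a b v (c , d) ≡ true
covers⁺ a≤c c<v v<d d≤b = ∧≡true⁺ (≤ᵇ-true a≤c) (∧≡true⁺ (<ᵇ-true c<v) (∧≡true⁺ (<ᵇ-true v<d) (≤ᵇ-true d≤b)))

hides⁻ : ∀ {a b v c d} → hides a b v (c , d) ≡ true →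
  a ≤ c × c < v × v < d × d ≤ b × sameChord (c , d) (a , b) ≡ false
hides⁻ {a} e with ∧≡true⁻ {a ≤ᵇ _} e
... | e₁ , e₂ with ∧≡true⁻ e₂
... | e₃ , e₄ with ∧≡true⁻ e₄
... | e₅ , e₆ with ∧≡true⁻ e₆
... | e₇ , e₈ = ≤ᵇ-true⁻ e₁ , <ᵇ-true⁻ e₃ , <ᵇ-true⁻ e₅ , ≤ᵇ-true⁻ e₇ , not≡true⇒≡false e₈

crosses⁻ : ∀ {a b c d} → crosses (a , b) (c , d) ≡ true → (a < c × c < b × b < d) ⊎ (c < a × a < d × d < b)
crosses⁻ {a} {b} {c} {d} e with (a <ᵇ c) ∧ (c <ᵇ b) ∧ (b <ᵇ d) in e₁
... | true with ∧≡true⁻ {a <ᵇ c} e₁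
...   | p , q with ∧≡true⁻ q
...     | q₁ , q₂ = inj₁ (<ᵇ-true⁻ p , <ᵇ-true⁻ q₁ , <ᵇ-true⁻ q₂)
crosses⁻ {a} {b} {c} {d} e | false with ∧≡true⁻ {c <ᵇ a} e
... | p , q with ∧≡true⁻ q
...   | q₁ , q₂ = inj₂ (<ᵇ-true⁻ p , <ᵇ-true⁻ q₁ , <ᵇ-true⁻ q₂)

crosses⁺ : ∀ {a b c d} → a < c → c < b → b < d → crosses (a , b) (c , d) ≡ true
crosses⁺ a<c c<b b<d rewrite <ᵇ-true a<c | <ᵇ-true c<b | <ᵇ-true b<d = refl

isChordIn⁺ : ∀ {c d x y} → c ≤ x → suc (suc x) ≤ y → y ≤ d → isChordIn c d (x , y) ≡ true
isChordIn⁺ c≤x x+2≤y y≤d = ∧≡true⁺ (≤ᵇ-true c≤x) (∧≡true⁺ (≤ᵇ-true x+2≤y) (≤ᵇ-true y≤d))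

isChordIn⁻ : ∀ {c d x y} → isChordIn c d (x , y) ≡ true → c ≤ x × suc (suc x) ≤ y × y ≤ d
isChordIn⁻ {c} e with ∧≡true⁻ {c ≤ᵇ _} e
... | e₁ , e₂ with ∧≡true⁻ e₂
... | e₃ , e₄ = ≤ᵇ-true⁻ e₁ , ≤ᵇ-true⁻ e₃ , ≤ᵇ-true⁻ e₄

x+2≤y⇒x≤y : ∀ {x y} → suc (suc x) ≤ y → x ≤ y
x+2≤y⇒x≤y {x} x+2≤y = ≤-trans (n≤1+n x) (≤-trans (n≤1+n (suc x)) x+2≤y)

∈chordsIn⁻ : ∀ {c k x y} → (x , y) ∈ chordsIn c k → c ≤ x × suc (suc x) ≤ y × y ≤ c + k
∈chordsIn⁻ {c} {k} m = isChordIn⁻ (from-T (proj₂ (∈-filter⁻ (T? ∘ isChordIn c (c + k)) m)))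

∈chordsIn⁺ : ∀ {c k x y} → c ≤ x → suc (suc x) ≤ y → y ≤ c + k → (x , y) ∈ chordsIn c k
∈chordsIn⁺ {c} {k} c≤x x+2≤y y≤c+k = ∈-filter⁺ (T? ∘ isChordIn c (c + k))
  (∈-cartesianProduct⁺ (∈-upTo⁺ (s≤s (≤-trans (x+2≤y⇒x≤y x+2≤y) y≤c+k))) (∈-upTo⁺ (s≤s y≤c+k)))
  (to-T (isChordIn⁺ c≤x x+2≤y y≤c+k))

chordsIn-unique : ∀ c k → Unique (chordsIn c k)
chordsIn-unique c k = Unique.filter⁺ (T? ∘ isChordIn c (c + k))
  (Unique.cartesianProduct⁺ (Unique.upTo⁺ (suc (c + k))) (Unique.upTo⁺ (suc (c + k))))

nonCrossing-↭ : ∀ {S S'} → S ↭ S' → nonCrossing S ≡ nonCrossing S'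
nonCrossing-↭ {S} {S'} p = trans (all-↭ _ p) (all-cong _ _ S' (λ x _ → all-↭ _ p))

cellInnerSize-↭ : ∀ {S S'} → S ↭ S' → ∀ t → cellInnerSize S t ≡ cellInnerSize S' t
cellInnerSize-↭ p (a , b) = count-ext _ _ (suc a) (b ∸ a ∸ 1) (λ v → cong not (any-↭ (hides a b v) p))

openCount-↭ : ∀ {S S'} → S ↭ S' → ∀ c d → openCount S c d ≡ openCount S' c d
openCount-↭ p c d = count-ext _ _ (suc c) (d ∸ c ∸ 1) (λ v → cong not (any-↭ (covers c d v) p))

shift : ℕ → Chord → Chord
shift t (x , y) = (t + x , t + y)

shift-injective : ∀ t {p q} → shift t p ≡ shift t q → p ≡ q
shift-injective t {x , y} {x' , y'} e =
  cong₂ _,_ (+-cancelˡ-≡ t x x' (cong proj₁ e)) (+-cancelˡ-≡ t y y' (cong proj₂ e))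

<ᵇ-shift : ∀ t a b → ((t + a) <ᵇ (t + b)) ≡ (a <ᵇ b)
<ᵇ-shift zero    a b = refl
<ᵇ-shift (suc t) a b = <ᵇ-shift t a b

≤ᵇ-shift : ∀ t a b → ((t + a) ≤ᵇ (t + b)) ≡ (a ≤ᵇ b)
≤ᵇ-shift zero    a b = refl
≤ᵇ-shift (suc t) a b = trans (≤ᵇ-suc (t + a) (t + b)) (≤ᵇ-shift t a b)
  where
  ≤ᵇ-suc : ∀ m n → (suc m ≤ᵇ suc n) ≡ (m ≤ᵇ n)
  ≤ᵇ-suc zero    n = refl
  ≤ᵇ-suc (suc m) n = refl

≡ᵇ-shift : ∀ t a b → ((t + a) ≡ᵇ (t + b)) ≡ (a ≡ᵇ b)
≡ᵇ-shift zero    a b = refl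
≡ᵇ-shift (suc t) a b = ≡ᵇ-shift t a b

crosses-shift : ∀ t p q → crosses (shift t p) (shift t q) ≡ crosses p q
crosses-shift t (a , b) (c , d)
  rewrite <ᵇ-shift t a c | <ᵇ-shift t c b | <ᵇ-shift t b d | <ᵇ-shift t c a | <ᵇ-shift t a d | <ᵇ-shift t d b = refl

covers-shift : ∀ t a b v q → covers (t + a) (t + b) (t + v) (shift t q) ≡ covers a b v q
covers-shift t a b v (c , d) rewrite ≤ᵇ-shift t a c | <ᵇ-shift t c v | <ᵇ-shift t v d | ≤ᵇ-shift t d b = refl

hides-shift : ∀ t a b v q → hides (t + a) (t + b) (t + v) (shift t q) ≡ hides a b v q
hides-shift t a b v (c , d)
  rewrite ≤ᵇ-shift t a c | <ᵇ-shift t c v | <ᵇ-shift t v d | ≤ᵇ-shift t d b | ≡ᵇ-shift t c a | ≡ᵇ-shift t d b = refl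

nonCrossing-shift : ∀ t S → nonCrossing (map (shift t) S) ≡ nonCrossing S
nonCrossing-shift t S = trans (all-map _ (shift t) S) (all-cong _ _ S (λ p _ →
  trans (all-map _ (shift t) S) (all-cong _ _ S (λ q _ → cong not (crosses-shift t p q)))))

count-interval-shift : ∀ (f : ℕ → Bool) t a b →
  count f (suc (t + a)) ((t + b) ∸ (t + a) ∸ 1) ≡ count (λ u → f (t + u)) (suc a) (b ∸ a ∸ 1)
count-interval-shift f t a b =
  trans (cong₂ (count f) (sym (+-suc t a)) (cong (_∸ 1) ([m+n]∸[m+o]≡n∸o t b a)))
        (count-shift f t (suc a) (b ∸ a ∸ 1))

cellInnerSize-shift : ∀ t S q → cellInnerSize (map (shift t) S) (shift t q) ≡ cellInnerSize S q
cellInnerSize-shift t S (a , b) =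
  trans (count-interval-shift (λ v → not (any (hides (t + a) (t + b) v) (map (shift t) S))) t a b)
        (count-ext _ (λ v → not (any (hides a b v) S)) (suc a) (b ∸ a ∸ 1) (λ u → cong not
          (trans (any-map (hides (t + a) (t + b) (t + u)) (shift t) S) (any-cong _ _ S (λ q _ → hides-shift t a b u q)))))

openCount-shift : ∀ t S c d → openCount (map (shift t) S) (t + c) (t + d) ≡ openCount S c d
openCount-shift t S c d =
  trans (count-interval-shift (isOpen (map (shift t) S) (t + c) (t + d)) t c d)
        (count-ext _ (isOpen S c d) (suc c) (d ∸ c ∸ 1) (λ u → cong not
          (trans (any-map (covers (t + c) (t + d) (t + u)) (shift t) S) (any-cong _ _ S (λ q _ → covers-shift t c d u q)))))

chordsIn-shift : ∀ t k {q} → q ∈ chordsIn t k ⇔ q ∈ map (shift t) (chordsIn 0 k)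
chordsIn-shift t k {x , y} = mk⇔ to from
  where
  to : (x , y) ∈ chordsIn t k → (x , y) ∈ map (shift t) (chordsIn 0 k)
  to m with ∈chordsIn⁻ {t} {k} m
  ... | t≤x , x+2≤y , y≤t+k = subst (_∈ map (shift t) (chordsIn 0 k)) back
        (∈-map⁺ (shift t) (∈chordsIn⁺ {0} {k} z≤n x+2≤y' y'≤k))
    where
    back : shift t (x ∸ t , y ∸ t) ≡ (x , y)
    back = cong₂ _,_ (m+[n∸m]≡n t≤x) (m+[n∸m]≡n (≤-trans t≤x (x+2≤y⇒x≤y x+2≤y)))
    x+2≤y' : suc (suc (x ∸ t)) ≤ y ∸ t
    x+2≤y' = subst (_≤ y ∸ t) (+-∸-assoc 2 t≤x) (∸-monoˡ-≤ t x+2≤y)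
    y'≤k : y ∸ t ≤ k
    y'≤k = subst (y ∸ t ≤_) (m+n∸m≡n t k) (∸-monoˡ-≤ t y≤t+k)
  from : (x , y) ∈ map (shift t) (chordsIn 0 k) → (x , y) ∈ chordsIn t k
  from m with ∈-map⁻ (shift t) m
  ... | (x' , y') , m' , refl with ∈chordsIn⁻ {0} {k} m'
  ... | _ , x'+2≤y' , y'≤k = ∈chordsIn⁺ {t} {k} (m≤m+n t x')
        (subst (_≤ t + y') (trans (+-suc t (suc x')) (cong suc (+-suc t x'))) (+-monoʳ-≤ t x'+2≤y'))
        (+-monoʳ-≤ t y'≤k)

ChordsWithin : ℕ → ℕ → List Chord → Set
ChordsWithin c d T = ∀ {x y} → (x , y) ∈ T → c ≤ x × suc (suc x) ≤ y × y ≤ d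

module Concatenation (i w : ℕ) (T₁ T₂ : List Chord)
  (T₁-in : ChordsWithin 0 (suc i) T₁) (T₂-in : ChordsWithin (suc i) (suc i + suc w) T₂) where

  v k : ℕ
  v = suc i
  k = suc i + suc w

  v≤k : v ≤ k
  v≤k = m≤m+n (suc i) (suc w)

  separated : ∀ {a b c d} → (a , b) ∈ T₁ → (c , d) ∈ T₂ → b ≤ c
  separated m₁ m₂ = ≤-trans (proj₂ (proj₂ (T₁-in m₁))) (proj₁ (T₂-in m₂))

  crosses-₁₂ : ∀ p q → p ∈ T₁ → q ∈ T₂ → crosses p q ≡ false
  crosses-₁₂ (a , b) (c , d) m₁ m₂ = ≢true⇒≡false λ e → case (crosses⁻ e)
    where
    case : _ → ⊥
    case (inj₁ (_ , c<b , _)) = <⇒≱ c<b (separated m₁ m₂)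
    case (inj₂ (c<a , _ , _)) = <⇒≱ (<-≤-trans c<a (x+2≤y⇒x≤y (proj₁ (proj₂ (T₁-in m₁))))) (separated m₁ m₂)

  crosses-₂₁ : ∀ p q → p ∈ T₂ → q ∈ T₁ → crosses p q ≡ false
  crosses-₂₁ (c , d) (a , b) m₂ m₁ = ≢true⇒≡false λ e → case (crosses⁻ e)
    where
    case : _ → ⊥
    case (inj₂ (_ , c<b , _)) = <⇒≱ c<b (separated m₁ m₂)
    case (inj₁ (c<a , _ , _)) = <⇒≱ (<-≤-trans c<a (x+2≤y⇒x≤y (proj₁ (proj₂ (T₁-in m₁))))) (separated m₁ m₂)

  nonCrossing-++ : nonCrossing (T₁ ++ T₂) ≡ nonCrossing T₁ ∧ nonCrossing T₂
  nonCrossing-++ = trans (all-++ _ T₁ T₂) (cong₂ _∧_ left right)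
    where
    left : all (λ p → all (λ q → not (crosses p q)) (T₁ ++ T₂)) T₁ ≡ nonCrossing T₁
    left = all-cong _ _ T₁ (λ p m → trans (all-++ _ T₁ T₂)
      (trans (cong (all (λ q → not (crosses p q)) T₁ ∧_) (all-true _ T₂ (λ q m' → cong not (crosses-₁₂ p q m m'))))
             (∧-identityʳ _)))
    right : all (λ p → all (λ q → not (crosses p q)) (T₁ ++ T₂)) T₂ ≡ nonCrossing T₂
    right = all-cong _ _ T₂ (λ p m → trans (all-++ _ T₁ T₂)
      (cong (_∧ all (λ q → not (crosses p q)) T₂) (all-true _ T₁ (λ q m' → cong not (crosses-₂₁ p q m m')))))

  cellInnerSize-++ˡ : ∀ t → t ∈ T₁ → cellInnerSize (T₁ ++ T₂) t ≡ cellInnerSize T₁ t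
  cellInnerSize-++ˡ (a , b) mt = count-ext _ _ (suc a) (b ∸ a ∸ 1) (λ u → cong not
    (trans (any-++ _ T₁ T₂) (trans (cong (any (hides a b u) T₁ ∨_) (any-false _ T₂ (λ where
      (c , d) m → ≢true⇒≡false λ e → unhidden m (hides⁻ {a} {b} {u} e)))) (∨-identityʳ _))))
    where
    unhidden : ∀ {c d u} → (c , d) ∈ T₂ → a ≤ c × c < u × u < d × d ≤ b × _ → ⊥
    unhidden m (_ , c<u , u<d , d≤b , _) = <⇒≱ (<-trans c<u u<d) (≤-trans d≤b (separated mt m))

  cellInnerSize-++ʳ : ∀ t → t ∈ T₂ → cellInnerSize (T₁ ++ T₂) t ≡ cellInnerSize T₂ t
  cellInnerSize-++ʳ (a , b) mt = count-ext _ _ (suc a) (b ∸ a ∸ 1) (λ u → cong not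
    (trans (any-++ _ T₁ T₂) (cong (_∨ any (hides a b u) T₂) (any-false _ T₁ (λ where
      (c , d) m → ≢true⇒≡false λ e → unhidden m (hides⁻ {a} {b} {u} e))))))
    where
    unhidden : ∀ {c d u} → (c , d) ∈ T₁ → a ≤ c × c < u × u < d × d ≤ b × _ → ⊥
    unhidden m (a≤c , c<u , u<d , _) = <⇒≱ (<-trans c<u u<d) (≤-trans (separated m mt) a≤c)

  covers-₁ : ∀ u q → q ∈ T₁ → covers 0 k u q ≡ covers 0 v u q
  covers-₁ u (c , d) m = cong (λ z → (0 ≤ᵇ c) ∧ (c <ᵇ u) ∧ (u <ᵇ d) ∧ z)
    (trans (≤ᵇ-true (≤-trans (proj₂ (proj₂ (T₁-in m))) v≤k)) (sym (≤ᵇ-true (proj₂ (proj₂ (T₁-in m))))))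

  covers-₂ : ∀ u q → q ∈ T₂ → covers 0 k u q ≡ covers v k u q
  covers-₂ u (c , d) m = cong (λ z → z ∧ (c <ᵇ u) ∧ (u <ᵇ d) ∧ (d ≤ᵇ k)) (sym (≤ᵇ-true (proj₁ (T₂-in m))))

  covers-₁-right : ∀ u q → v ≤ u → q ∈ T₁ → covers 0 k u q ≡ false
  covers-₁-right u (c , d) v≤u m = ≢true⇒≡false λ e →
    <⇒≱ (proj₁ (proj₂ (proj₂ (covers⁻ {0} {k} {u} {c} {d} e)))) (≤-trans (proj₂ (proj₂ (T₁-in m))) v≤u)

  covers-₂-left : ∀ u q → u ≤ v → q ∈ T₂ → covers 0 k u q ≡ false
  covers-₂-left u (c , d) u≤v m = ≢true⇒≡false λ e →
    <⇒≱ (proj₁ (proj₂ (covers⁻ {0} {k} {u} {c} {d} e))) (≤-trans u≤v (proj₁ (T₂-in m)))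

  isOpen-left : ∀ u → u ≤ v → isOpen (T₁ ++ T₂) 0 k u ≡ isOpen T₁ 0 v u
  isOpen-left u u≤v = cong not (trans (any-++ _ T₁ T₂) (trans
    (cong₂ _∨_ (any-cong _ _ T₁ (covers-₁ u)) (any-false _ T₂ (λ q → covers-₂-left u q u≤v)))
    (∨-identityʳ _)))

  isOpen-right : ∀ u → v ≤ u → isOpen (T₁ ++ T₂) 0 k u ≡ isOpen T₂ v k u
  isOpen-right u v≤u = cong not (trans (any-++ _ T₁ T₂)
    (cong₂ _∨_ (any-false _ T₁ (λ q → covers-₁-right u q v≤u)) (any-cong _ _ T₂ (covers-₂ u))))

  isOpen-split : isOpen (T₁ ++ T₂) 0 k v ≡ true
  isOpen-split = cong not (trans (any-++ _ T₁ T₂)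
    (cong₂ _∨_ (any-false _ T₁ (λ q → covers-₁-right v q ≤-refl)) (any-false _ T₂ (λ q → covers-₂-left v q ≤-refl))))

  openCount-below-split : count (isOpen (T₁ ++ T₂) 0 k) 1 i ≡ openCount T₁ 0 v
  openCount-below-split = count-cong (isOpen (T₁ ++ T₂) 0 k) (isOpen T₁ 0 v) 1 i (λ j j<i → isOpen-left (suc j) (s≤s (<⇒≤ j<i)))

  openCount-++ : openCount (T₁ ++ T₂) 0 k ≡ openCount T₁ 0 v + suc (openCount T₂ v k)
  openCount-++ =
    trans (∑-+ i (suc w) (λ j → 𝟙 (f (1 + j))))
    (cong₂ _+_ openCount-below-split
      (trans (∑-suc w (λ j → 𝟙 (f (suc (i + j)))))
        (cong₂ _+_ (trans (cong (λ z → 𝟙 (f (suc z))) (+-identityʳ i)) (cong 𝟙 isOpen-split))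
          (trans (∑-ext w (λ j → cong (λ z → 𝟙 (f (suc z))) (+-suc i j)))
            (trans (∑-cong w (λ j _ → cong 𝟙 (isOpen-right (suc (suc (i + j))) (s≤s (≤-trans (m≤m+n i j) (n≤1+n _))))))
              (cong (λ n → ∑ n (λ j → 𝟙 (isOpen T₂ v k (suc v + j)))) (sym right-length)))))))
    where
    f : ℕ → Bool
    f = isOpen (T₁ ++ T₂) 0 k
    right-length : k ∸ v ∸ 1 ≡ w
    right-length = cong (_∸ 1) (m+n∸m≡n (suc i) (suc w))

-- Dissections of the polygon as chord sets on an interval

root : ℕ → Chord
root n = (0 , suc n)

isDiagonal : ℕ → Chord → Bool
isDiagonal n (i , j) = (i + 2 ≤ᵇ j) ∧ not ((i ≡ᵇ 0) ∧ (j ≡ᵇ suc n))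

diagonals-filter : ∀ n → diagonals n ≡ filterᵇ (isDiagonal n) (cartesianProduct (upTo (n + 2)) (upTo (n + 2)))
diagonals-filter n = rows (upTo (n + 2))
  where
  row : ∀ i (L : List ℕ) →
    concatMap (λ j → if isDiagonal n (i , j) then [ (i , j) ] else []) L ≡ filterᵇ (isDiagonal n) (map (i ,_) L)
  row i []      = refl
  row i (j ∷ L) with isDiagonal n (i , j)
  ... | true  = cong ((i , j) ∷_) (row i L)
  ... | false = row i L
  rows : ∀ (L : List ℕ) →
    concatMap (λ i → concatMap (λ j → if isDiagonal n (i , j) then [ (i , j) ] else []) (upTo (n + 2))) L
      ≡ filterᵇ (isDiagonal n) (cartesianProduct L (upTo (n + 2)))
  rows []      = refl
  rows (i ∷ L) = trans (cong₂ _++_ (row i (upTo (n + 2))) (rows L))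
    (sym (filter-++ (T? ∘ isDiagonal n) (map (i ,_) (upTo (n + 2))) (cartesianProduct L (upTo (n + 2)))))

diagonals-unique : ∀ n → Unique (diagonals n)
diagonals-unique n rewrite diagonals-filter n =
  Unique.filter⁺ (T? ∘ isDiagonal n) (Unique.cartesianProduct⁺ (Unique.upTo⁺ (n + 2)) (Unique.upTo⁺ (n + 2)))

≢root⇒ : ∀ {n x y} → (x , y) ≢ root n → not ((x ≡ᵇ 0) ∧ (y ≡ᵇ suc n)) ≡ true
≢root⇒ {n} {x} {y} h with x ≟ 0 | y ≟ suc n
... | yes refl | yes refl = ⊥-elim (h refl)
... | yes refl | no y≢   rewrite ≡ᵇ-false y≢ = refl
... | no x≢    | _       rewrite ≡ᵇ-false x≢ = refl

⇒≢root : ∀ {n x y} → not ((x ≡ᵇ 0) ∧ (y ≡ᵇ suc n)) ≡ true → (x , y) ≢ root n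
⇒≢root {n} e refl rewrite ≡ᵇ-true {n} refl = true≢false (sym e)

∈diagonals⁻ : ∀ {n x y} → (x , y) ∈ diagonals n → suc (suc x) ≤ y × y ≤ suc n × (x , y) ≢ root n
∈diagonals⁻ {n} {x} {y} m rewrite diagonals-filter n
  with ∈-filter⁻ (T? ∘ isDiagonal n) {xs = cartesianProduct (upTo (n + 2)) (upTo (n + 2))} m
... | m' , t with ∧≡true⁻ {x + 2 ≤ᵇ y} (from-T t) | ∈-cartesianProduct⁻ (upTo (n + 2)) (upTo (n + 2)) m'
... | e₁ , e₂ | _ , y∈ = subst (_≤ y) (+-comm x 2) (≤ᵇ-true⁻ e₁)
                       , ≤-pred (subst (y <_) (+-comm n 2) (∈-upTo⁻ y∈)) , ⇒≢root {n} e₂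

∈diagonals⁺ : ∀ {n x y} → suc (suc x) ≤ y → y ≤ suc n → (x , y) ≢ root n → (x , y) ∈ diagonals n
∈diagonals⁺ {n} {x} {y} x+2≤y y≤n+1 ≢root rewrite diagonals-filter n =
  ∈-filter⁺ (T? ∘ isDiagonal n) (∈-cartesianProduct⁺ (∈-upTo⁺ (below (x+2≤y⇒x≤y x+2≤y))) (∈-upTo⁺ (below ≤-refl)))
    (to-T (∧≡true⁺ (≤ᵇ-true (subst (_≤ y) (+-comm 2 x) x+2≤y)) (≢root⇒ ≢root)))
  where
  below : ∀ {z} → z ≤ y → z < n + 2
  below {z} z≤y = subst (z <_) (+-comm 2 n) (s≤s (≤-trans z≤y y≤n+1))

root∷diagonals-unique : ∀ n → Unique (root n ∷ diagonals n)
root∷diagonals-unique n =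
  All.tabulate (λ m e → proj₂ (proj₂ (∈diagonals⁻ {n} (subst (_∈ diagonals n) (sym e) m))) refl) ∷ diagonals-unique n

chordsIn≈root∷diagonals : ∀ n → 1 ≤ n → ∀ {q} → q ∈ chordsIn 0 (suc n) ⇔ q ∈ root n ∷ diagonals n
chordsIn≈root∷diagonals n 1≤n {x , y} = mk⇔ to from
  where
  to : (x , y) ∈ chordsIn 0 (suc n) → (x , y) ∈ root n ∷ diagonals n
  to m with ∈chordsIn⁻ {0} {suc n} m
  ... | _ , x+2≤y , y≤ with x ≟ 0 | y ≟ suc n
  ... | yes refl | yes refl = here refl
  ... | yes refl | no y≢    = there (∈diagonals⁺ x+2≤y y≤ (y≢ ∘ cong proj₂))
  ... | no x≢    | _        = there (∈diagonals⁺ x+2≤y y≤ (x≢ ∘ cong proj₁))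
  from : (x , y) ∈ root n ∷ diagonals n → (x , y) ∈ chordsIn 0 (suc n)
  from (here refl) = ∈chordsIn⁺ {0} {suc n} z≤n (s≤s 1≤n) ≤-refl
  from (there m) with ∈diagonals⁻ {n} m
  ... | x+2≤y , y≤ , _ = ∈chordsIn⁺ {0} {suc n} z≤n x+2≤y y≤

length-filter-upTo : ∀ (g : ℕ → Bool) N → length (filterᵇ g (upTo N)) ≡ ∑ N (𝟙 ∘ g)
length-filter-upTo g N = go id N
  where
  go : ∀ (f : ℕ → ℕ) N → length (filterᵇ g (applyUpTo f N)) ≡ ∑ N (𝟙 ∘ g ∘ f)
  go f zero    = refl
  go f (suc N) = trans (head (g (f 0))) (sym (∑-suc N (𝟙 ∘ g ∘ f)))
    where
    head : ∀ b → length (filterᵇ g (applyUpTo f (suc N))) ≡ 𝟙 (g (f 0)) + ∑ N (𝟙 ∘ g ∘ f ∘ suc)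
    head _ with g (f 0)
    ... | true  = cong suc (go (f ∘ suc) N)
    ... | false = go (f ∘ suc) N

∑-window≤ : ∀ (H : ℕ → Bool) a b N → N ≤ b →
  ∑ N (λ v → 𝟙 ((a <ᵇ v) ∧ (v <ᵇ b) ∧ H v)) ≡ ∑ (N ∸ suc a) (λ i → 𝟙 (H (suc a + i)))
∑-window≤ H a b zero    _ = refl
∑-window≤ H a b (suc N) N<b with a <? N
... | no a≮N = trans (cong₂ _+_ (∑-window≤ H a b N (≤-trans (n≤1+n N) N<b))
                                (cong (λ z → 𝟙 (z ∧ (N <ᵇ b) ∧ H N)) (<ᵇ-false a≮N)))
  (trans (+-identityʳ _) (cong (λ z → ∑ z (λ i → 𝟙 (H (suc a + i))))
    (trans (m≤n⇒m∸n≡0 (≤-trans (≮⇒≥ a≮N) (n≤1+n a))) (sym (m≤n⇒m∸n≡0 (≮⇒≥ a≮N))))))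
... | yes a<N = trans (cong₂ _+_ (∑-window≤ H a b N (≤-trans (n≤1+n N) N<b))
                                 (cong 𝟙 (trans (cong (λ z → z ∧ (N <ᵇ b) ∧ H N) (<ᵇ-true a<N)) (cong (_∧ H N) (<ᵇ-true N<b)))))
  (trans (cong (λ z → ∑ (N ∸ suc a) (λ i → 𝟙 (H (suc a + i))) + 𝟙 (H z)) (sym (m+[n∸m]≡n a<N)))
    (cong (λ z → ∑ z (λ i → 𝟙 (H (suc a + i)))) (sym (+-∸-assoc 1 a<N))))

∑-window : ∀ (H : ℕ → Bool) a b N → a < b → b ≤ N →
  ∑ N (λ v → 𝟙 ((a <ᵇ v) ∧ (v <ᵇ b) ∧ H v)) ≡ count H (suc a) (b ∸ a ∸ 1)
∑-window H a b N a<b b≤N =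
  trans (∑-pad b N b≤N (λ i b≤i _ →
          trans (cong (λ z → 𝟙 ((a <ᵇ i) ∧ z ∧ H i)) (<ᵇ-false (λ i<b → <⇒≱ i<b b≤i))) (cong 𝟙 (∧-zeroʳ (a <ᵇ i)))))
  (trans (∑-window≤ H a b b ≤-refl)
    (cong (λ z → ∑ z (λ i → 𝟙 (H (suc a + i)))) (sym (trans (∸-+-assoc b a 1) (cong (b ∸_) (+-comm a 1))))))

cellSize≡2+cellInnerSize : ∀ n S a b → a < b → b ≤ suc n → cellSize n S (a , b) ≡ 2 + cellInnerSize S (a , b)
cellSize≡2+cellInnerSize n S a b a<b b≤n+1 = cong (2 +_) (trans (length-filter-upTo _ (n + 2))
  (∑-window (λ v → not (any (hides a b v) S)) a b (n + 2) a<b (subst (b ≤_) (+-comm 2 n) (≤-trans b≤n+1 (n≤1+n _)))))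

module WithRoot (n : ℕ) (T : List Chord) (T⊆ : T ⊆ diagonals n) where

  ∈T⁻ : ∀ {x y} → (x , y) ∈ T → suc (suc x) ≤ y × y ≤ suc n × (x , y) ≢ root n
  ∈T⁻ m = ∈diagonals⁻ {n} (T⊆ m)

  nonCrossing-root∷ : nonCrossing (root n ∷ T) ≡ nonCrossing T
  nonCrossing-root∷ = cong₂ _∧_ (all-true _ T (λ q m → cong not (root-crosses q m)))
    (all-cong _ _ T (λ p m → cong (λ b → not b ∧ all (λ q → not (crosses p q)) T) (crosses-root p m)))
    where
    root-crosses : ∀ q → q ∈ T → crosses (root n) q ≡ false
    root-crosses (c , d) m = ≢true⇒≡false λ e → case (crosses⁻ {0} {suc n} {c} {d} e)
      where
      case : _ → ⊥
      case (inj₁ (_ , _ , n+1<d)) = <⇒≱ n+1<d (proj₁ (proj₂ (∈T⁻ m)))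
    crosses-root : ∀ q → q ∈ T → crosses q (root n) ≡ false
    crosses-root (c , d) m = ≢true⇒≡false λ e → case (crosses⁻ {c} {d} {0} {suc n} e)
      where
      case : _ → ⊥
      case (inj₂ (_ , _ , n+1<d)) = <⇒≱ n+1<d (proj₁ (proj₂ (∈T⁻ m)))

  cellInnerSize-root∷ : ∀ t → t ∈ T → cellInnerSize (root n ∷ T) t ≡ cellInnerSize T t
  cellInnerSize-root∷ (a , b) mt = count-ext _ _ (suc a) (b ∸ a ∸ 1)
    (λ u → cong (λ z → not (z ∨ any (hides a b u) T)) (≢true⇒≡false λ e → root-hidden (hides⁻ {a} {b} {u} e)))
    where
    root-hidden : ∀ {u} → a ≤ 0 × 0 < u × u < suc n × suc n ≤ b × _ → ⊥
    root-hidden (a≤0 , _ , _ , n+1≤b , _) with ∈T⁻ mt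
    ... | _ , b≤n+1 , ≢root = ≢root (cong₂ _,_ (n≤0⇒n≡0 a≤0) (≤-antisym b≤n+1 n+1≤b))

  cellInnerSize-root∷-root : cellInnerSize (root n ∷ T) (root n) ≡ cellInnerSize T (root n)
  cellInnerSize-root∷-root = count-ext _ _ 1 n (λ u → cong (λ z → not (z ∨ any (hides 0 (suc n) u) T))
    (≢true⇒≡false λ e → true≢false
      (trans (sym (≡ᵇ-true {n} refl)) (proj₂ (proj₂ (proj₂ (proj₂ (hides⁻ {0} {suc n} {u} {0} {suc n} e))))))))

  cellInnerSize-root : cellInnerSize T (root n) ≡ openCount T 0 (suc n)
  cellInnerSize-root = count-ext _ _ 1 n (λ u → cong not (any-cong _ _ T (λ where
    (c , d) m → cong (λ z → (0 ≤ᵇ c) ∧ (c <ᵇ u) ∧ (u <ᵇ d) ∧ z)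
                     (trans (cong ((d ≤ᵇ suc n) ∧_) (≢root⇒ (proj₂ (proj₂ (∈T⁻ m))))) (∧-identityʳ _)))))

  openCount-root∷ : openCount (root n ∷ T) 0 (suc n) ≡ 0
  openCount-root∷ = ∑-zero n (λ i i<n → cong (λ z → 𝟙 (not (z ∨ any (covers 0 (suc n) (suc i)) T)))
    (covers⁺ {0} {suc n} {suc i} {0} {suc n} z≤n (s≤s z≤n) (s≤s i<n) ≤-refl))

  cellSize-cellTops : ∀ t → t ∈ root n ∷ T → cellSize n T t ≡ 2 + cellInnerSize T t
  cellSize-cellTops _       (here refl) = cellSize≡2+cellInnerSize n T 0 (suc n) (s≤s z≤n) ≤-refl
  cellSize-cellTops (a , b) (there m) with ∈T⁻ m
  ... | a+2≤b , b≤n+1 , _ = cellSize≡2+cellInnerSize n T a b (≤-trans (n≤1+n (suc a)) a+2≤b) b≤n+1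

farthest₀ : List Chord → ℕ
farthest₀ []             = 1
farthest₀ ((x , y) ∷ S) = if x ≡ᵇ 0 then y ⊔ farthest₀ S else farthest₀ S

farthest₀-≥ : ∀ S {y} → (0 , y) ∈ S → y ≤ farthest₀ S
farthest₀-≥ ((x , y') ∷ S) (here refl) = m≤m⊔n y' (farthest₀ S)
farthest₀-≥ ((x , y') ∷ S) (there m) with x ≡ᵇ 0
... | true  = ≤-trans (farthest₀-≥ S m) (m≤n⊔m y' (farthest₀ S))
... | false = farthest₀-≥ S m

farthest₀-attained : ∀ S → farthest₀ S ≡ 1 ⊎ (0 , farthest₀ S) ∈ S
farthest₀-attained [] = inj₁ refl
farthest₀-attained ((x , y) ∷ S) with x ≟ 0
... | no x≢0 rewrite ≡ᵇ-false x≢0 with farthest₀-attained S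
...   | inj₁ e = inj₁ e
...   | inj₂ m = inj₂ (there m)
farthest₀-attained ((x , y) ∷ S) | yes refl with ⊔-sel y (farthest₀ S)
... | inj₁ e rewrite e = inj₂ (here refl)
... | inj₂ e rewrite e with farthest₀-attained S
...   | inj₁ e' = inj₁ e'
...   | inj₂ m  = inj₂ (there m)

farthest₀-≤ : ∀ S B → 1 ≤ B → (∀ {y} → (0 , y) ∈ S → y ≤ B) → farthest₀ S ≤ B
farthest₀-≤ []             B 1≤B h = 1≤B
farthest₀-≤ ((x , y) ∷ S) B 1≤B h with x ≡ᵇ 0 in e
... | true rewrite ≡ᵇ-true⁻ {x} e = ⊔-lub (h (here refl)) (farthest₀-≤ S B 1≤B (h ∘ there))
... | false = farthest₀-≤ S B 1≤B (h ∘ there)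

farthest₀-positive : ∀ S → 1 ≤ farthest₀ S
farthest₀-positive [] = ≤-refl
farthest₀-positive ((x , y) ∷ S) with x ≡ᵇ 0
... | true  = ≤-trans (farthest₀-positive S) (m≤n⊔m y (farthest₀ S))
... | false = farthest₀-positive S

-- In a dissection of a polygon with at least four vertices, the farthest vertex
-- joined to 0 by a diagonal is not passed over by any diagonal.
openCount-positive : ∀ n T → T ⊆ diagonals (suc n) → nonCrossing T ≡ true →
  1 ≤ openCount T 0 (suc (suc n))
openCount-positive n T T⊆ nc =
  subst (_≤ openCount T 0 k) (cong 𝟙 u-open) (∑-≥ (suc n) (λ i → 𝟙 (f (1 + i))) (u ∸ 1) u-1<n+1)
  where
  k : ℕ
  k = suc (suc n)
  f = isOpen T 0 k
  u = farthest₀ T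
  open WithRoot (suc n) T T⊆ using (∈T⁻)
  u≤n+1 : u ≤ suc n
  u≤n+1 = farthest₀-≤ T (suc n) (s≤s z≤n) bound
    where
    bound : ∀ {y} → (0 , y) ∈ T → y ≤ suc n
    bound {y} m with ∈T⁻ m
    ... | _ , y≤ , ≢root with y ≟ k
    ...   | yes refl = ⊥-elim (≢root refl)
    ...   | no y≢    = ≤-pred (≤∧≢⇒< y≤ y≢)
  u-1<n+1 : u ∸ 1 < suc n
  u-1<n+1 = s≤s (∸-monoˡ-≤ 1 u≤n+1)
  uncovered : ∀ q → q ∈ T → covers 0 k u q ≡ false
  uncovered (c , d) m = ≢true⇒≡false λ e → case (covers⁻ {0} {k} {u} {c} {d} e)
    where
    case : 0 ≤ c × c < u × u < d × d ≤ k → ⊥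
    case (_ , c<u , u<d , _) with c ≟ 0
    ... | yes refl = <⇒≱ u<d (farthest₀-≥ T m)
    ... | no c≢0 with farthest₀-attained T
    ...   | inj₁ u≡1 = c≢0 (n≤0⇒n≡0 (≤-pred (subst (c <_) u≡1 c<u)))
    ...   | inj₂ m₀  = true≢false (trans (sym (crosses⁺ {0} {u} {c} {d} (n≢0⇒n>0 c≢0) c<u u<d))
                          (not≡true⇒≡false (all-true⁻ _ T (all-true⁻ _ T nc (0 , u) m₀) (c , d) m)))
  u-open : f (1 + (u ∸ 1)) ≡ true
  u-open = trans (cong f (m+[n∸m]≡n (farthest₀-positive T))) (cong not (any-false _ T uncovered))

oneₚ-∸ : ∀ {N i} b → i < suc N → i ≢ N → oneₚ (N ∸ i) b ≡ 0
oneₚ-∸ {N} {i} b i≤N i≢N with N ∸ i in e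
... | zero  = ⊥-elim (i≢N (≤-antisym (≤-pred i≤N) (m∸n≡0⇒m≤n e)))
... | suc _ = refl

oneₚ-0-∸ : ∀ {m j} → j < suc m → j ≢ m → oneₚ 0 (m ∸ j) ≡ 0
oneₚ-0-∸ {m} {j} j≤m j≢m with m ∸ j in e
... | zero  = ⊥-elim (j≢m (≤-antisym (≤-pred j≤m) (m∸n≡0⇒m≤n e)))
... | suc _ = refl

⊛-identityʳ : ∀ (F : PS) N m → (F ⊛ oneₚ) N m ≡ F N m
⊛-identityʳ F N m = begin
  (F ⊛ oneₚ) N m                                     ≡⟨ sumTo≡∑ N _ ⟩
  ∑ (suc N) (λ i → sumTo m (λ j → F i j * oneₚ (N ∸ i) (m ∸ j)))
    ≡⟨ ∑-single (suc N) N {λ i → sumTo m (λ j → F i j * oneₚ (N ∸ i) (m ∸ j))} ≤-refl (λ i i≤N i≢N →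
         trans (sumTo≡∑ m _) (∑-zero (suc m) (λ j _ → trans (cong (F i j *_) (oneₚ-∸ (m ∸ j) i≤N i≢N)) (*-zeroʳ (F i j))))) ⟩
  sumTo m (λ j → F N j * oneₚ (N ∸ N) (m ∸ j))
    ≡⟨ trans (sumTo≡∑ m _) (∑-ext (suc m) (λ j → cong (λ z → F N j * oneₚ z (m ∸ j)) (n∸n≡0 N))) ⟩
  ∑ (suc m) (λ j → F N j * oneₚ 0 (m ∸ j))
    ≡⟨ ∑-single (suc m) m {λ j → F N j * oneₚ 0 (m ∸ j)} ≤-refl (λ j j≤m j≢m →
         trans (cong (F N j *_) (oneₚ-0-∸ j≤m j≢m)) (*-zeroʳ (F N j))) ⟩
  F N m * oneₚ 0 (m ∸ m)                             ≡⟨ cong (λ z → F N m * oneₚ 0 z) (n∸n≡0 m) ⟩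
  F N m * 1                                          ≡⟨ *-identityʳ _ ⟩
  F N m                                              ∎
  where open ≡-Reasoning

⊛-∑ : ∀ (F G : PS) n m → (F ⊛ G) n m ≡ ∑ (suc n) (λ i → ∑ (suc m) (λ j → F i j * G (n ∸ i) (m ∸ j)))
⊛-∑ F G n m = trans (sumTo≡∑ n _) (∑-ext (suc n) (λ i → sumTo≡∑ m _))

mono⊛ : ∀ a b (F : PS) n m → (mono a b ⊛ F) n m ≡ 𝟙 (a <ᵇ suc n) * (𝟙 (b <ᵇ suc m) * F (n ∸ a) (m ∸ b))
mono⊛ a b F n m =
  trans (sumTo≡∑ n _)
  (trans (∑-ext (suc n) (λ i → trans (sumTo≡∑ m _)
            (trans (∑-ext (suc m) (λ j → trans (cong (_* F (n ∸ i) (m ∸ j)) (𝟙-∧ (i ≡ᵇ a) (j ≡ᵇ b)))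
                                               (*-assoc (𝟙 (i ≡ᵇ a)) (𝟙 (j ≡ᵇ b)) _)))
            (trans (∑-*ˡ (suc m) (𝟙 (i ≡ᵇ a)) (λ j → 𝟙 (j ≡ᵇ b) * F (n ∸ i) (m ∸ j)))
              (cong (𝟙 (i ≡ᵇ a) *_) (∑-𝟙≡ (suc m) b (λ j → F (n ∸ i) (m ∸ j))))))))
    (∑-𝟙≡ (suc n) a (λ i → 𝟙 (b <ᵇ suc m) * F (n ∸ i) (m ∸ b))))

-- For ℓ ≥ 1 the multiple d with r = ℓ * d is unique, so the sum is 0 or 1.
periodicSize-multiples : ∀ ℓ r N → .{{_ : NonZero ℓ}} → r < N →
  𝟙 (periodicSize ℓ (3 + r)) ≡ ∑ N (λ d → 𝟙 (r ≡ᵇ ℓ * d))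
periodicSize-multiples ℓ r N r<N with r % ℓ ≟ 0
... | yes r%ℓ≡0 = trans
  (cong 𝟙 (any-true (λ d → (3 + r) ≡ᵇ (3 + ℓ * d)) (upTo (suc (3 + r))) (∈-upTo⁺ q<) (≡ᵇ-true (cong (3 +_) r≡ℓq))))
  (sym (trans (∑-single N q (≤-<-trans q≤r r<N) (λ d _ d≢q →
                 cong 𝟙 (≡ᵇ-false (λ e → d≢q (*-cancelˡ-≡ d q ℓ (trans (sym e) r≡ℓq))))))
              (cong 𝟙 (≡ᵇ-true r≡ℓq))))
  where
  q = r / ℓ
  r≡ℓq : r ≡ ℓ * q
  r≡ℓq = trans (m≡m%n+[m/n]*n r ℓ) (trans (cong (_+ q * ℓ) r%ℓ≡0) (*-comm q ℓ))
  q≤r : q ≤ r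
  q≤r = subst (q ≤_) (sym r≡ℓq) (m≤n*m q ℓ)
  q< : q < suc (3 + r)
  q< = s≤s (≤-trans q≤r (m≤n+m r 3))
... | no r%ℓ≢0 = trans
  (cong 𝟙 (any-false (λ d → (3 + r) ≡ᵇ (3 + ℓ * d)) (upTo (suc (3 + r))) (λ d _ → ≡ᵇ-false (not-multiple d ∘ +-cancelˡ-≡ 3 _ _))))
                      (sym (∑-zero N (λ d _ → cong 𝟙 (≡ᵇ-false (not-multiple d)))))
  where
  not-multiple : ∀ d → r ≢ ℓ * d
  not-multiple d e = r%ℓ≢0 (trans (cong (_% ℓ) (trans e (*-comm ℓ d))) (m*n%n≡0 d ℓ))

𝟙-+≡-convolution : ∀ l₁ l₂ m →
  𝟙 ((l₁ + l₂) ≡ᵇ m) ≡ ∑ (suc m) (λ j → 𝟙 (l₁ ≡ᵇ j) * 𝟙 (l₂ ≡ᵇ (m ∸ j)))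
𝟙-+≡-convolution l₁ l₂ m = trans (split l₁ m) (sym (trans
  (∑-ext (suc m) (λ j → cong (λ z → 𝟙 z * 𝟙 (l₂ ≡ᵇ (m ∸ j))) (≡ᵇ-sym l₁ j)))
  (∑-𝟙≡ (suc m) l₁ (λ j → 𝟙 (l₂ ≡ᵇ (m ∸ j))))))
  where
  split : ∀ l₁ m → 𝟙 ((l₁ + l₂) ≡ᵇ m) ≡ 𝟙 (l₁ <ᵇ suc m) * 𝟙 (l₂ ≡ᵇ (m ∸ l₁))
  split zero     m       = sym (+-identityʳ _)
  split (suc l₁) zero    = refl
  split (suc l₁) (suc m) = split l₁ m

+-suc-≡ᵇ : ∀ o₁ o₂ r₂ → ((o₁ + suc o₂) ≡ᵇ suc (o₁ + r₂)) ≡ (o₂ ≡ᵇ r₂)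
+-suc-≡ᵇ zero     o₂ r₂ = refl
+-suc-≡ᵇ (suc o₁) o₂ r₂ = +-suc-≡ᵇ o₁ o₂ r₂

-- The indicator of a concatenation T₁ ++ T₂ whose (r₁+1)-th open vertex is the split
-- point, with nᵢ, aᵢ, oᵢ, lᵢ the non-crossing flag, periodicity flag, number of open
-- vertices and length of Tᵢ.
𝟙-concatenation : ∀ (n₁ n₂ a₁ a₂ : Bool) o₁ o₂ r₁ r₂ l₁ l₂ m →
    𝟙 (((n₁ ∧ n₂) ∧ (a₁ ∧ a₂) ∧ ((o₁ + suc o₂) ≡ᵇ suc (r₁ + r₂))) ∧ ((l₁ + l₂) ≡ᵇ m)) * 𝟙 (true ∧ (o₁ ≡ᵇ r₁))
  ≡ ∑ (suc m) (λ j → 𝟙 ((n₁ ∧ a₁ ∧ (o₁ ≡ᵇ r₁)) ∧ (l₁ ≡ᵇ j))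
                   * 𝟙 ((n₂ ∧ a₂ ∧ (o₂ ≡ᵇ r₂)) ∧ (l₂ ≡ᵇ (m ∸ j))))
𝟙-concatenation false n₂ a₁ a₂ o₁ o₂ r₁ r₂ l₁ l₂ m = sym (∑-zero (suc m) (λ _ _ → refl))
𝟙-concatenation true false a₁ a₂ o₁ o₂ r₁ r₂ l₁ l₂ m =
  sym (∑-zero (suc m) (λ j _ → *-zeroʳ (𝟙 ((a₁ ∧ (o₁ ≡ᵇ r₁)) ∧ (l₁ ≡ᵇ j)))))
𝟙-concatenation true true false a₂ o₁ o₂ r₁ r₂ l₁ l₂ m = sym (∑-zero (suc m) (λ _ _ → refl))
𝟙-concatenation true true true false o₁ o₂ r₁ r₂ l₁ l₂ m =
  sym (∑-zero (suc m) (λ j _ → *-zeroʳ (𝟙 ((o₁ ≡ᵇ r₁) ∧ (l₁ ≡ᵇ j)))))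
𝟙-concatenation true true true true o₁ o₂ r₁ r₂ l₁ l₂ m with o₁ ≟ r₁
... | no o₁≢r₁ rewrite ≡ᵇ-false o₁≢r₁ =
  trans (*-zeroʳ (𝟙 (((o₁ + suc o₂) ≡ᵇ suc (r₁ + r₂)) ∧ ((l₁ + l₂) ≡ᵇ m)))) (sym (∑-zero (suc m) (λ _ _ → refl)))
... | yes refl rewrite ≡ᵇ-true {o₁} refl | +-suc-≡ᵇ o₁ o₂ r₂ with o₂ ≡ᵇ r₂
...   | false = sym (∑-zero (suc m) (λ j _ → *-zeroʳ (𝟙 (l₁ ≡ᵇ j))))
...   | true  = trans (*-identityʳ _) (𝟙-+≡-convolution l₁ l₂ m)

∧-rearrange : ∀ a b c → ((a ∧ b ∧ true) ∧ c) ≡ (a ∧ c ∧ b)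
∧-rearrange true  true  c     = sym (∧-identityʳ c)
∧-rearrange true  false true  = refl
∧-rearrange true  false false = refl
∧-rearrange false b     c     = refl

-- Splitting the indicator of a dissection by the number o = r + 1 of inner vertices of
-- its root cell; P 2 ≡ false rules out o = 0.
𝟙-root-cell : ∀ (nc pc : Bool) o l m n (P : ℕ → Bool) → P 2 ≡ false → o ≤ n →
  𝟙 (nc ∧ (suc l ≡ᵇ m) ∧ (P (2 + o) ∧ pc))
  ≡ 𝟙 (1 ≤ᵇ m) * ∑ (suc n) (λ r → 𝟙 (P (3 + r)) * 𝟙 ((nc ∧ pc ∧ (o ≡ᵇ suc r)) ∧ (l ≡ᵇ (m ∸ 1))))
𝟙-root-cell false pc o l m n P _ _ =
  sym (trans (cong (𝟙 (1 ≤ᵇ m) *_) (∑-zero (suc n) (λ r _ → *-zeroʳ (𝟙 (P (3 + r)))))) (*-zeroʳ (𝟙 (1 ≤ᵇ m))))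
𝟙-root-cell true false o l m n P _ _ =
  trans (cong (λ z → 𝟙 ((suc l ≡ᵇ m) ∧ z)) (∧-zeroʳ (P (2 + o))))
  (trans (cong 𝟙 (∧-zeroʳ (suc l ≡ᵇ m)))
   (sym (trans (cong (𝟙 (1 ≤ᵇ m) *_) (∑-zero (suc n) (λ r _ → *-zeroʳ (𝟙 (P (3 + r)))))) (*-zeroʳ (𝟙 (1 ≤ᵇ m))))))
𝟙-root-cell true true o l zero n P _ _ = refl
𝟙-root-cell true true zero l (suc m) n P P2≡false _ =
  trans (cong (λ z → 𝟙 ((l ≡ᵇ m) ∧ (z ∧ true))) P2≡false)
  (trans (cong 𝟙 (∧-zeroʳ (l ≡ᵇ m)))
    (sym (trans (+-identityʳ _) (∑-zero (suc n) (λ r _ → *-zeroʳ (𝟙 (P (3 + r))))))))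
𝟙-root-cell true true (suc o) l (suc m) n P _ o<n = begin
  𝟙 ((l ≡ᵇ m) ∧ P (3 + o) ∧ true)              ≡⟨ cong (λ z → 𝟙 ((l ≡ᵇ m) ∧ z)) (∧-identityʳ (P (3 + o))) ⟩
  𝟙 ((l ≡ᵇ m) ∧ P (3 + o))                     ≡⟨ trans (𝟙-∧ (l ≡ᵇ m) (P (3 + o))) (*-comm (𝟙 (l ≡ᵇ m)) _) ⟩
  𝟙 (P (3 + o)) * 𝟙 (l ≡ᵇ m)                   ≡⟨ cong (λ z → 𝟙 (P (3 + o)) * 𝟙 (z ∧ (l ≡ᵇ m))) (sym (≡ᵇ-true {o} refl)) ⟩
  f o                                           ≡⟨ sym (∑-single (suc n) o (≤-trans o<n (n≤1+n n)) only-o) ⟩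
  ∑ (suc n) f                                   ≡⟨ sym (+-identityʳ _) ⟩
  ∑ (suc n) f + 0                               ∎
  where
  open ≡-Reasoning
  f : ℕ → ℕ
  f r = 𝟙 (P (3 + r)) * 𝟙 ((o ≡ᵇ r) ∧ (l ≡ᵇ m))
  only-o : ∀ r → r < suc n → r ≢ o → f r ≡ 0
  only-o r _ r≢o = trans (cong (λ z → 𝟙 (P (3 + r)) * 𝟙 (z ∧ (l ≡ᵇ m))) (≡ᵇ-false (≢-sym r≢o))) (*-zeroʳ (𝟙 (P (3 + r))))

-- Periodic chord sets on an interval

module Periodic (ℓ : ℕ) where

  periodicCells : List Chord → Bool
  periodicCells S = all (λ t → periodicSize ℓ (2 + cellInnerSize S t)) S

  isSegmentDissection : ℕ → ℕ → ℕ → List Chord → Bool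
  isSegmentDissection r c d S = nonCrossing S ∧ periodicCells S ∧ (openCount S c d ≡ᵇ r)

  segIndicator : ℕ → ℕ → ℕ → ℕ → List Chord → ℕ
  segIndicator r c d m S = 𝟙 (isSegmentDissection r c d S ∧ (length S ≡ᵇ m))

  -- Coefficient of z^(k-1-r) w^m in D^(r+1): an (r+1)-tuple of dissections laid side by
  -- side on [0 , k], glued at the r open vertices.
  segCount : ℕ → ℕ → ℕ → ℕ
  segCount k r m = ∑⊆ (segIndicator r 0 k m) (chordsIn 0 k)

  periodicCells-↭ : ∀ {S S'} → S ↭ S' → periodicCells S ≡ periodicCells S'
  periodicCells-↭ {S} {S'} p = trans (all-↭ _ p) (all-cong _ _ S' (λ t _ → cong (λ x → periodicSize ℓ (2 + x)) (cellInnerSize-↭ p t)))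

  segIndicator-↭ : ∀ r c d m → PermutationInvariant (segIndicator r c d m)
  segIndicator-↭ r c d m p rewrite nonCrossing-↭ p | periodicCells-↭ p | openCount-↭ p c d | ↭-length p = refl

  periodicCells-shift : ∀ t S → periodicCells (map (shift t) S) ≡ periodicCells S
  periodicCells-shift t S = trans (all-map _ (shift t) S)
    (all-cong _ _ S (λ q _ → cong (λ x → periodicSize ℓ (2 + x)) (cellInnerSize-shift t S q)))

  segIndicator-shift : ∀ t r c d m S → segIndicator r (t + c) (t + d) m (map (shift t) S) ≡ segIndicator r c d m S
  segIndicator-shift t r c d m S
    rewrite nonCrossing-shift t S | periodicCells-shift t S | openCount-shift t S c d | length-map (shift t) S = refl

  segCount-shift : ∀ t w r m → ∑⊆ (segIndicator r t (t + w) m) (chordsIn t w) ≡ segCount w r m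
  segCount-shift t w r m =
    trans (∑⊆-sameSet _ (segIndicator-↭ r t (t + w) m) (chordsIn-unique t w)
                        (Unique.map⁺ (shift-injective t) (chordsIn-unique 0 w)) (chordsIn-shift t w))
    (trans (∑⊆-map (shift t) _ (chordsIn 0 w))
      (∑⊆-ext _ _ (chordsIn 0 w) (λ T →
        trans (cong (λ z → segIndicator r z (t + w) m (map (shift t) T)) (sym (+-identityʳ t)))
              (segIndicator-shift t r 0 w m T))))

  segIndicator≢0⇒openCount : ∀ r c d m S → segIndicator r c d m S ≢ 0 → openCount S c d ≡ r
  segIndicator≢0⇒openCount r c d m S h = ≡ᵇ-true⁻
    (proj₂ (∧≡true⁻ {periodicCells S} (proj₂ (∧≡true⁻ {nonCrossing S} (proj₁ (∧≡true⁻ (𝟙≢0⇒≡true h)))))))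

  segIndicator≢0⇒nonCrossing : ∀ r c d m S → segIndicator r c d m S ≢ 0 → nonCrossing S ≡ true
  segIndicator≢0⇒nonCrossing r c d m S h = proj₁ (∧≡true⁻ (proj₁ (∧≡true⁻ (𝟙≢0⇒≡true h))))

  segCount-vanishes : ∀ k r m → k ∸ 1 < r → segCount k r m ≡ 0
  segCount-vanishes k r m k-1<r = ∑⊆-zero _ (chordsIn 0 k) λ T _ → decidable-stable (_ ≟ 0) λ ≢0 →
    <⇒≱ k-1<r (subst (_≤ k ∸ 1) (segIndicator≢0⇒openCount r 0 k m T ≢0) (count≤ (isOpen T 0 k) 1 (k ∸ 1)))

  periodicCells-++ : ∀ i w T₁ T₂ → ChordsWithin 0 (suc i) T₁ → ChordsWithin (suc i) (suc i + suc w) T₂ →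
    periodicCells (T₁ ++ T₂) ≡ periodicCells T₁ ∧ periodicCells T₂
  periodicCells-++ i w T₁ T₂ T₁-in T₂-in = trans (all-++ _ T₁ T₂) (cong₂ _∧_
    (all-cong _ _ T₁ (λ t m → cong (λ z → periodicSize ℓ (2 + z)) (cellInnerSize-++ˡ t m)))
    (all-cong _ _ T₂ (λ t m → cong (λ z → periodicSize ℓ (2 + z)) (cellInnerSize-++ʳ t m))))
    where open Concatenation i w T₁ T₂ T₁-in T₂-in

  -- Cutting [0 , k] at its (r₁+1)-th open vertex.
  module Factorisation (r₁ r₂ m : ℕ) where

    markedIndicator : ℕ → ℕ → List Chord → ℕ
    markedIndicator i k S =
      segIndicator (suc (r₁ + r₂)) 0 k m S * 𝟙 (isOpen S 0 k (suc i) ∧ (count (isOpen S 0 k) 1 i ≡ᵇ r₁))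

    markedIndicator-↭ : ∀ i k → PermutationInvariant (markedIndicator i k)
    markedIndicator-↭ i k {S} {S'} p = cong₂ _*_ (segIndicator-↭ (suc (r₁ + r₂)) 0 k m p)
      (cong 𝟙 (cong₂ _∧_ (cong not (any-↭ _ p))
        (cong (_≡ᵇ r₁) (count-ext (isOpen S 0 k) (isOpen S' 0 k) 1 i (λ u → cong not (any-↭ (covers 0 k u) p))))))

    segIndicator-by-cut : ∀ k S → segIndicator (suc (r₁ + r₂)) 0 k m S ≡ ∑ (k ∸ 1) (λ i → markedIndicator i k S)
    segIndicator-by-cut k S = sym (begin
      ∑ (k ∸ 1) (λ i → markedIndicator i k S)                         ≡⟨ ∑-*ˡ (k ∸ 1) (segIndicator _ 0 k m S) _ ⟩
      segIndicator _ 0 k m S * ∑ (k ∸ 1) (λ i → 𝟙 (f (1 + i) ∧ _))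
        ≡⟨ cong (segIndicator _ 0 k m S *_) (count-rank f 1 r₁ (k ∸ 1)) ⟩
      segIndicator _ 0 k m S * 𝟙 (r₁ <ᵇ count f 1 (k ∸ 1))            ≡⟨ 𝟙-*-implied _ _ enough-open ⟩
      segIndicator _ 0 k m S                                           ∎)
      where
      open ≡-Reasoning
      f = isOpen S 0 k
      enough-open : isSegmentDissection (suc (r₁ + r₂)) 0 k S ∧ (length S ≡ᵇ m) ≡ true → (r₁ <ᵇ count f 1 (k ∸ 1)) ≡ true
      enough-open e = <ᵇ-true (subst (r₁ <_) (sym (≡ᵇ-true⁻ {openCount S 0 k}
        (proj₂ (∧≡true⁻ {periodicCells S} (proj₂ (∧≡true⁻ {nonCrossing S} (proj₁ (∧≡true⁻ e))))))))
        (s≤s (m≤m+n r₁ r₂)))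

    module _ (i w : ℕ) where

      k : ℕ
      k = suc i + suc w

      left right : List Chord
      left  = chordsIn 0 (suc i)
      right = chordsIn (suc i) (suc w)

      isChordOnEitherSide : Chord → Bool
      isChordOnEitherSide q = isChordIn 0 (suc i) q ∨ isChordIn (suc i) k q

      -- a chord passing over the cut vertex keeps it from being open
      marked-sides : ∀ T → T ⊆ chordsIn 0 k → any (not ∘ isChordOnEitherSide) T ≡ true → markedIndicator i k T ≡ 0
      marked-sides T T⊆ e with any-true⁻ _ T e
      ... | (x , y) , m∈ , both with ∈chordsIn⁻ {0} {k} (T⊆ m∈)
      ...   | _ , x+2≤y , y≤k = trans
        (cong (λ z → segIndicator _ 0 k m T * 𝟙 (not z ∧ (count (isOpen T 0 k) 1 i ≡ᵇ r₁)))
              (any-true (covers 0 k (suc i)) T m∈ (covers⁺ z≤n x<cut cut<y y≤k)))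
        (*-zeroʳ (segIndicator _ 0 k m T))
        where
        not-left : isChordIn 0 (suc i) (x , y) ≡ false
        not-left = proj₁ (not∨≡true⁻ both)
        not-right : isChordIn (suc i) k (x , y) ≡ false
        not-right = proj₂ (not∨≡true⁻ {isChordIn 0 (suc i) (x , y)} both)
        cut<y : suc i < y
        cut<y with suc i <? y
        ... | yes p = p
        ... | no ¬p = ⊥-elim (true≢false (trans (sym (isChordIn⁺ z≤n x+2≤y (≮⇒≥ ¬p))) not-left))
        x<cut : x < suc i
        x<cut with x <? suc i
        ... | yes p = p
        ... | no ¬p = ⊥-elim (true≢false (trans (sym (isChordIn⁺ (≮⇒≥ ¬p) x+2≤y y≤k)) not-right))

      left-right-disjoint : ∀ {q} → ¬ (q ∈ left × q ∈ right)
      left-right-disjoint {x , y} (mˡ , mʳ) with ∈chordsIn⁻ {0} {suc i} mˡ | ∈chordsIn⁻ {suc i} {suc w} mʳ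
      ... | _ , _ , y≤cut | cut≤x , x+2≤y , _ =
        <⇒≱ (≤-trans (s≤s y≤cut) (≤-trans (s≤s cut≤x) (≤-trans (n≤1+n _) x+2≤y))) ≤-refl

      sides≈left++right : ∀ {q} → q ∈ filterᵇ isChordOnEitherSide (chordsIn 0 k) ⇔ q ∈ left ++ right
      sides≈left++right {x , y} = mk⇔ to from
        where
        to : (x , y) ∈ filterᵇ isChordOnEitherSide (chordsIn 0 k) → (x , y) ∈ left ++ right
        to m with ∈-filter⁻ (T? ∘ isChordOnEitherSide) {xs = chordsIn 0 k} m
        ... | _ , either with isChordIn 0 (suc i) (x , y) in inLeft
        ...   | true with isChordIn⁻ {0} {suc i} inLeft
        ...     | 0≤x , x+2≤y , y≤cut = ∈-++⁺ˡ (∈chordsIn⁺ 0≤x x+2≤y y≤cut)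
        to m  | _ , either | false with isChordIn⁻ {suc i} {k} (from-T either)
        ...     | cut≤x , x+2≤y , y≤k = ∈-++⁺ʳ left (∈chordsIn⁺ {suc i} {suc w} cut≤x x+2≤y y≤k)
        from : (x , y) ∈ left ++ right → (x , y) ∈ filterᵇ isChordOnEitherSide (chordsIn 0 k)
        from m with ∈-++⁻ left m
        ... | inj₁ mˡ with ∈chordsIn⁻ {0} {suc i} mˡ
        ...   | _ , x+2≤y , y≤cut = ∈-filter⁺ (T? ∘ isChordOnEitherSide)
                  (∈chordsIn⁺ {0} {k} z≤n x+2≤y (≤-trans y≤cut (m≤m+n (suc i) (suc w))))
                  (to-T (cong (_∨ isChordIn (suc i) k (x , y)) (isChordIn⁺ z≤n x+2≤y y≤cut)))
        from m | inj₂ mʳ with ∈chordsIn⁻ {suc i} {suc w} mʳ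
        ...   | cut≤x , x+2≤y , y≤k = ∈-filter⁺ (T? ∘ isChordOnEitherSide) (∈chordsIn⁺ {0} {k} z≤n x+2≤y y≤k)
                  (to-T (trans (cong (isChordIn 0 (suc i) (x , y) ∨_) (isChordIn⁺ cut≤x x+2≤y y≤k)) (∨-zeroʳ _)))

      markedIndicator-++ : ∀ T₁ T₂ → T₁ ⊆ left → T₂ ⊆ right →
        markedIndicator i k (T₁ ++ T₂) ≡ ∑ (suc m) (λ j → segIndicator r₁ 0 (suc i) j T₁ * segIndicator r₂ (suc i) k (m ∸ j) T₂)
      markedIndicator-++ T₁ T₂ T₁⊆ T₂⊆ =
        trans (cong₂ (λ X Y → 𝟙 X * 𝟙 Y)
                (cong₂ _∧_ (cong₂ _∧_ nonCrossing-++
                                      (cong₂ _∧_ (periodicCells-++ i w T₁ T₂ T₁-in T₂-in) (cong (_≡ᵇ _) openCount-++)))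
                           (cong (_≡ᵇ m) (length-++ T₁)))
                (cong₂ _∧_ isOpen-split (cong (_≡ᵇ r₁) openCount-below-split)))
          (𝟙-concatenation (nonCrossing T₁) (nonCrossing T₂) (periodicCells T₁) (periodicCells T₂)
                           (openCount T₁ 0 (suc i)) (openCount T₂ (suc i) k) r₁ r₂ (length T₁) (length T₂) m)
        where
        T₁-in : ChordsWithin 0 (suc i) T₁
        T₁-in m = ∈chordsIn⁻ {0} {suc i} (T₁⊆ m)
        T₂-in : ChordsWithin (suc i) k T₂
        T₂-in m = ∈chordsIn⁻ {suc i} {suc w} (T₂⊆ m)
        open Concatenation i w T₁ T₂ T₁-in T₂-in using (nonCrossing-++; openCount-++; isOpen-split; openCount-below-split)

      ∑⊆-markedIndicator : ∑⊆ (markedIndicator i k) (chordsIn 0 k)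
        ≡ ∑ (suc m) (λ j → segCount (suc i) r₁ j * segCount (suc w) r₂ (m ∸ j))
      ∑⊆-markedIndicator = begin
          ∑⊆ (markedIndicator i k) (chordsIn 0 k)
        ≡⟨ ∑⊆-filter isChordOnEitherSide _ (chordsIn 0 k) marked-sides ⟩
          ∑⊆ (markedIndicator i k) (filterᵇ isChordOnEitherSide (chordsIn 0 k))
        ≡⟨ ∑⊆-sameSet _ (markedIndicator-↭ i k) (Unique.filter⁺ (T? ∘ isChordOnEitherSide) (chordsIn-unique 0 k))
                       (Unique.++⁺ (chordsIn-unique 0 (suc i)) (chordsIn-unique (suc i) (suc w)) left-right-disjoint)
                       sides≈left++right ⟩
          ∑⊆ (markedIndicator i k) (left ++ right)
        ≡⟨ ∑⊆-++ _ left right ⟩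
          ∑⊆ (λ T₁ → ∑⊆ (λ T₂ → markedIndicator i k (T₁ ++ T₂)) right) left
        ≡⟨ ∑⊆-cong _ _ left (λ T₁ T₁⊆ → ∑⊆-cong _ _ right (λ T₂ T₂⊆ → markedIndicator-++ T₁ T₂ T₁⊆ T₂⊆)) ⟩
          ∑⊆ (λ T₁ → ∑⊆ (λ T₂ → ∑ (suc m) (λ j → W₁ j T₁ * W₂ j T₂)) right) left
        ≡⟨ ∑⊆-ext _ _ left (λ T₁ → trans (∑⊆-∑ (suc m) (λ j T₂ → W₁ j T₁ * W₂ j T₂) right)
                                         (∑-ext (suc m) (λ j → ∑⊆-*ˡ (W₁ j T₁) (W₂ j) right))) ⟩
          ∑⊆ (λ T₁ → ∑ (suc m) (λ j → W₁ j T₁ * ∑⊆ (W₂ j) right)) left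
        ≡⟨ ∑⊆-∑ (suc m) (λ j T₁ → W₁ j T₁ * ∑⊆ (W₂ j) right) left ⟩
          ∑ (suc m) (λ j → ∑⊆ (λ T₁ → W₁ j T₁ * ∑⊆ (W₂ j) right) left)
        ≡⟨ ∑-ext (suc m) (λ j → trans (∑⊆-*ʳ (∑⊆ (W₂ j) right) (W₁ j) left)
                                      (cong (segCount (suc i) r₁ j *_) (segCount-shift (suc i) (suc w) r₂ (m ∸ j)))) ⟩
          ∑ (suc m) (λ j → segCount (suc i) r₁ j * segCount (suc w) r₂ (m ∸ j))
        ∎
        where
        open ≡-Reasoning
        W₁ W₂ : ℕ → List Chord → ℕ
        W₁ j = segIndicator r₁ 0 (suc i) j
        W₂ j = segIndicator r₂ (suc i) k (m ∸ j)

  segCount-split : ∀ r₁ r₂ m k → segCount k (suc (r₁ + r₂)) m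
    ≡ ∑ (k ∸ 1) (λ i → ∑ (suc m) (λ j → segCount (suc i) r₁ j * segCount (k ∸ suc i) r₂ (m ∸ j)))
  segCount-split r₁ r₂ m k =
    trans (∑⊆-ext _ _ (chordsIn 0 k) (segIndicator-by-cut k))
    (trans (∑⊆-∑ (k ∸ 1) (λ i → markedIndicator i k) (chordsIn 0 k))
      (∑-cong (k ∸ 1) (λ i i<k-1 → at-cut i (k ∸ suc i ∸ 1) k (cut-length k i i<k-1))))
    where
    open Factorisation r₁ r₂ m using (segIndicator-by-cut; markedIndicator; ∑⊆-markedIndicator)
    at-cut : ∀ i w k' → suc i + suc w ≡ k' → ∑⊆ (markedIndicator i k') (chordsIn 0 k')
      ≡ ∑ (suc m) (λ j → segCount (suc i) r₁ j * segCount (k' ∸ suc i) r₂ (m ∸ j))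
    at-cut i w .(suc i + suc w) refl = trans (∑⊆-markedIndicator i w)
      (∑-ext (suc m) (λ j → cong (λ z → segCount (suc i) r₁ j * segCount z r₂ (m ∸ j)) (sym (m+n∸m≡n (suc i) (suc w)))))

  isPeriodicDissection-root : ∀ n T → T ⊆ diagonals n → ∀ m → isPeriodicDissection ℓ n m T
    ≡ nonCrossing T ∧ (suc (length T) ≡ᵇ m) ∧ (periodicSize ℓ (2 + openCount T 0 (suc n)) ∧ periodicCells T)
  isPeriodicDissection-root n T T⊆ m = cong (λ z → nonCrossing T ∧ (suc (length T) ≡ᵇ m) ∧ z)
    (cong₂ _∧_ (cong (periodicSize ℓ) (trans (cellSize-cellTops (root n) (here refl)) (cong (2 +_) cellInnerSize-root)))
               (all-cong _ _ T (λ t m → cong (periodicSize ℓ) (cellSize-cellTops t (there m)))))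
    where open WithRoot n T T⊆

  periodicCells-root∷ : ∀ n T → T ⊆ diagonals n →
    periodicCells (root n ∷ T) ≡ periodicSize ℓ (2 + openCount T 0 (suc n)) ∧ periodicCells T
  periodicCells-root∷ n T T⊆ = cong₂ _∧_
    (cong (λ z → periodicSize ℓ (2 + z)) (trans cellInnerSize-root∷-root cellInnerSize-root))
    (all-cong _ _ T (λ t m → cong (λ z → periodicSize ℓ (2 + z)) (cellInnerSize-root∷ t m)))
    where open WithRoot n T T⊆

  -- A dissection of the (n+2)-gon is a chord set on [0 , n+1] containing the root,
  -- i.e. one with no open vertex.
  segCount-closed : ∀ n m → segCount (suc n) 0 m ≡ Dcoef ℓ n m
  segCount-closed zero m = cong 𝟙 (≡ᵇ-sym 0 m)
  segCount-closed (suc n) m =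
    trans (∑⊆-sameSet _ (segIndicator-↭ 0 0 k m) (chordsIn-unique 0 k) (root∷diagonals-unique (suc n))
                        (chordsIn≈root∷diagonals (suc n) (s≤s z≤n)))
    (trans (cong₂ _+_ with-root without-root) (+-identityʳ _))
    where
    k : ℕ
    k = suc (suc n)
    D = diagonals (suc n)
    with-root : ∑⊆ (λ T → segIndicator 0 0 k m (root (suc n) ∷ T)) D ≡ Dcoef ℓ (suc n) m
    with-root = trans (∑⊆-cong _ _ D (λ T T⊆ → begin
        segIndicator 0 0 k m (root (suc n) ∷ T)
      ≡⟨ cong (λ z → 𝟙 (z ∧ (suc (length T) ≡ᵇ m))) (cong₂ _∧_ (WithRoot.nonCrossing-root∷ (suc n) T T⊆)
           (cong₂ _∧_ (periodicCells-root∷ (suc n) T T⊆) (cong (_≡ᵇ 0) (WithRoot.openCount-root∷ (suc n) T T⊆)))) ⟩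
        𝟙 ((nonCrossing T ∧ (periodicSize ℓ (2 + openCount T 0 k) ∧ periodicCells T) ∧ true) ∧ (suc (length T) ≡ᵇ m))
      ≡⟨ cong 𝟙 (∧-rearrange (nonCrossing T) _ (suc (length T) ≡ᵇ m)) ⟩
        𝟙 (nonCrossing T ∧ (suc (length T) ≡ᵇ m) ∧ (periodicSize ℓ (2 + openCount T 0 k) ∧ periodicCells T))
      ≡⟨ cong 𝟙 (sym (isPeriodicDissection-root (suc n) T T⊆ m)) ⟩
        𝟙 (isPeriodicDissection ℓ (suc n) m T)
      ∎)) (sym (count-sublists (isPeriodicDissection ℓ (suc n) m) D))
      where open ≡-Reasoning
    without-root : ∑⊆ (segIndicator 0 0 k m) D ≡ 0
    without-root = ∑⊆-zero _ D λ T T⊆ → decidable-stable (_ ≟ 0) λ ≢0 →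
      <⇒≱ (subst (0 <_) (segIndicator≢0⇒openCount 0 0 k m T ≢0)
                 (openCount-positive n T T⊆ (segIndicator≢0⇒nonCrossing 0 0 k m T ≢0))) ≤-refl

  segCount-diagonals : ∀ n r m → segCount (suc (suc n)) (suc r) m ≡ ∑⊆ (segIndicator (suc r) 0 (suc (suc n)) m) (diagonals (suc n))
  segCount-diagonals n r m =
    trans (∑⊆-sameSet _ (segIndicator-↭ (suc r) 0 k m) (chordsIn-unique 0 k) (root∷diagonals-unique (suc n))
                        (chordsIn≈root∷diagonals (suc n) (s≤s z≤n)))
      (cong (_+ ∑⊆ (segIndicator (suc r) 0 k m) D) (∑⊆-zero _ D λ T T⊆ → decidable-stable (_ ≟ 0) λ ≢0 →
        1+n≢0 (trans (sym (segIndicator≢0⇒openCount (suc r) 0 k m (root (suc n) ∷ T) ≢0))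
                     (WithRoot.openCount-root∷ (suc n) T T⊆))))
    where
    k : ℕ
    k = suc (suc n)
    D = diagonals (suc n)

  -- Removing the root chord: the root cell then has r + 3 vertices, r + 1 of them open.
  Dcoef-root-cell : ∀ n m → Dcoef ℓ (suc n) m
    ≡ 𝟙 (1 ≤ᵇ m) * ∑ (suc (suc n)) (λ r → 𝟙 (periodicSize ℓ (3 + r)) * segCount (suc (suc n)) (suc r) (m ∸ 1))
  Dcoef-root-cell n m = begin
      Dcoef ℓ (suc n) m
    ≡⟨ count-sublists (isPeriodicDissection ℓ (suc n) m) D ⟩
      ∑⊆ (𝟙 ∘ isPeriodicDissection ℓ (suc n) m) D
    ≡⟨ ∑⊆-cong _ _ D by-root-cell ⟩
      ∑⊆ (λ T → 𝟙 (1 ≤ᵇ m) * ∑ (suc (suc n)) (λ r → 𝟙 (P (3 + r)) * segIndicator (suc r) 0 k (m ∸ 1) T)) D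
    ≡⟨ ∑⊆-*ˡ (𝟙 (1 ≤ᵇ m)) _ D ⟩
      𝟙 (1 ≤ᵇ m) * ∑⊆ (λ T → ∑ (suc (suc n)) (λ r → 𝟙 (P (3 + r)) * segIndicator (suc r) 0 k (m ∸ 1) T)) D
    ≡⟨ cong (𝟙 (1 ≤ᵇ m) *_) (trans (∑⊆-∑ (suc (suc n)) (λ r T → 𝟙 (P (3 + r)) * segIndicator (suc r) 0 k (m ∸ 1) T) D)
         (∑-ext (suc (suc n)) (λ r → trans (∑⊆-*ˡ (𝟙 (P (3 + r))) (segIndicator (suc r) 0 k (m ∸ 1)) D)
                                            (cong (𝟙 (P (3 + r)) *_) (sym (segCount-diagonals n r (m ∸ 1))))))) ⟩
      𝟙 (1 ≤ᵇ m) * ∑ (suc (suc n)) (λ r → 𝟙 (P (3 + r)) * segCount k (suc r) (m ∸ 1))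
    ∎
    where
    open ≡-Reasoning
    k : ℕ
    k = suc (suc n)
    D = diagonals (suc n)
    P = periodicSize ℓ
    by-root-cell : ∀ T → T ⊆ D → 𝟙 (isPeriodicDissection ℓ (suc n) m T)
      ≡ 𝟙 (1 ≤ᵇ m) * ∑ (suc (suc n)) (λ r → 𝟙 (P (3 + r)) * segIndicator (suc r) 0 k (m ∸ 1) T)
    by-root-cell T T⊆ = trans (cong 𝟙 (isPeriodicDissection-root (suc n) T T⊆ m))
      (𝟙-root-cell (nonCrossing T) (periodicCells T) (openCount T 0 k) (length T) m (suc n) P refl (count≤ (isOpen T 0 k) 1 (suc n)))

  segCount-vanishes≤ : ∀ k r m → 0 < r → k ≤ r → segCount k r m ≡ 0
  segCount-vanishes≤ zero    r m 0<r _   = segCount-vanishes 0 r m 0<r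
  segCount-vanishes≤ (suc k) r m _   k<r = segCount-vanishes (suc k) r m k<r

module Identities (ℓ' : ℕ) where

  ℓ : ℕ
  ℓ = suc ℓ'

  open Periodic ℓ

  D : PS
  D = Dgf ℓ

  D^-coefficient : ∀ r N m → (D ^ₚ suc r) N m ≡ segCount (N + suc r) r m
  D^-coefficient zero N m =
    trans (⊛-identityʳ D N m) (sym (trans (cong (λ z → segCount z 0 m) (+-comm N 1)) (segCount-closed N m)))
  D^-coefficient (suc r) N m = begin
      (D ^ₚ suc (suc r)) N m
    ≡⟨ ⊛-∑ D (D ^ₚ suc r) N m ⟩
      ∑ (suc N) (λ i → ∑ (suc m) (λ j → D i j * (D ^ₚ suc r) (N ∸ i) (m ∸ j)))
    ≡⟨ ∑-ext (suc N) (λ i → ∑-ext (suc m) (λ j → cong₂ _*_ (sym (segCount-closed i j)) (D^-coefficient r (N ∸ i) (m ∸ j)))) ⟩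
      ∑ (suc N) (λ i → ∑ (suc m) (λ j → segCount (suc i) 0 j * segCount (N ∸ i + suc r) r (m ∸ j)))
    ≡⟨ ∑-cong (suc N) (λ i i≤N → ∑-ext (suc m) (λ j →
         cong (λ z → segCount (suc i) 0 j * segCount z r (m ∸ j)) (sym (right-length i i≤N)))) ⟩
      ∑ (suc N) g
    ≡⟨ sym (+-identityʳ _) ⟩
      ∑ (suc N) g + 0
    ≡⟨ cong (∑ (suc N) g +_) (sym (∑-zero r (λ i i<r → ∑-zero (suc m) (λ j _ →
         trans (cong (segCount (suc (suc N + i)) 0 j *_) (segCount-vanishes≤ _ r (m ∸ j) (≤-<-trans z≤n i<r) (beyond i)))
               (*-zeroʳ (segCount (suc (suc N + i)) 0 j)))))) ⟩
      ∑ (suc N) g + ∑ r (λ i → g (suc N + i))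
    ≡⟨ sym (∑-+ (suc N) r g) ⟩
      ∑ (suc N + r) g
    ≡⟨ cong (λ z → ∑ z g) (sym k∸1) ⟩
      ∑ (k ∸ 1) g
    ≡⟨ sym (segCount-split 0 r m k) ⟩
      segCount k (suc r) m
    ∎
    where
    open ≡-Reasoning
    k : ℕ
    k = N + suc (suc r)
    g : ℕ → ℕ
    g i = ∑ (suc m) (λ j → segCount (suc i) 0 j * segCount (k ∸ suc i) r (m ∸ j))
    k∸1 : k ∸ 1 ≡ suc N + r
    k∸1 = trans (cong (_∸ 1) (+-suc N (suc r))) (+-suc N r)
    right-length : ∀ i → i < suc N → k ∸ suc i ≡ N ∸ i + suc r
    right-length i i≤N = trans (cong (_∸ suc i) (+-suc N (suc r))) (+-∸-comm (suc r) (≤-pred i≤N))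
    beyond : ∀ i → k ∸ suc (suc N + i) ≤ r
    beyond i = subst (_≤ r) (sym (trans (cong (_∸ suc (suc N + i)) (trans (+-suc N (suc r)) (cong suc (+-suc N r))))
                                         ([m+n]∸[m+o]≡n∸o (suc (suc N)) r i)))
                     (m∸n≤m r i)

  monomial-term : ∀ d n m → (mono (1 + d * ℓ) 1 ⊛ D ^ₚ (2 + d * ℓ)) n m ≡ 𝟙 (1 ≤ᵇ m) * segCount (suc n) (suc (d * ℓ)) (m ∸ 1)
  monomial-term d n m = trans (mono⊛ (1 + d * ℓ) 1 (D ^ₚ (2 + d * ℓ)) n m)
    (trans (cong (λ z → 𝟙 (suc (d * ℓ) <ᵇ suc n) * (𝟙 (1 <ᵇ suc m) * z))
                 (D^-coefficient (suc (d * ℓ)) (n ∸ suc (d * ℓ)) (m ∸ 1)))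
           (fits (d * ℓ <? n)))
    where
    fits : _ → 𝟙 (d * ℓ <ᵇ n) * (𝟙 (0 <ᵇ m) * segCount (n ∸ suc (d * ℓ) + suc (suc (d * ℓ))) (suc (d * ℓ)) (m ∸ 1))
             ≡ 𝟙 (0 <ᵇ m) * segCount (suc n) (suc (d * ℓ)) (m ∸ 1)
    fits (yes dℓ<n) rewrite <ᵇ-true dℓ<n = trans (+-identityʳ _)
      (cong (λ z → 𝟙 (0 <ᵇ m) * segCount z (suc (d * ℓ)) (m ∸ 1))
            (trans (+-suc (n ∸ suc (d * ℓ)) (suc (d * ℓ))) (cong suc (m∸n+n≡m dℓ<n))))
    fits (no dℓ≮n) rewrite <ᵇ-false dℓ≮n = sym (trans
      (cong (𝟙 (0 <ᵇ m) *_) (segCount-vanishes (suc n) (suc (d * ℓ)) (m ∸ 1) (s≤s (≮⇒≥ dℓ≮n)))) (*-zeroʳ (𝟙 (0 <ᵇ m))))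

  ∑-periodic-sizes : ∀ n (G : ℕ → ℕ) → (∀ r → n ≤ r → G r ≡ 0) →
    ∑ (suc n) (λ r → 𝟙 (periodicSize ℓ (3 + r)) * G r) ≡ ∑ (suc n) (λ d → G (d * ℓ))
  ∑-periodic-sizes n G G-vanishes = begin
      ∑ (suc n) (λ r → 𝟙 (periodicSize ℓ (3 + r)) * G r)
    ≡⟨ ∑-cong (suc n) (λ r r≤n → cong (_* G r) (periodicSize-multiples ℓ r (suc n) r≤n)) ⟩
      ∑ (suc n) (λ r → ∑ (suc n) (λ d → 𝟙 (r ≡ᵇ ℓ * d)) * G r)
    ≡⟨ ∑-ext (suc n) (λ r → sym (∑-*ʳ (suc n) (G r) (λ d → 𝟙 (r ≡ᵇ ℓ * d)))) ⟩
      ∑ (suc n) (λ r → ∑ (suc n) (λ d → 𝟙 (r ≡ᵇ ℓ * d) * G r))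
    ≡⟨ ∑-swap (suc n) (suc n) (λ r d → 𝟙 (r ≡ᵇ ℓ * d) * G r) ⟩
      ∑ (suc n) (λ d → ∑ (suc n) (λ r → 𝟙 (r ≡ᵇ ℓ * d) * G r))
    ≡⟨ ∑-ext (suc n) (λ d → trans (∑-𝟙≡ (suc n) (ℓ * d) G) (multiple d (ℓ * d <? suc n))) ⟩
      ∑ (suc n) (λ d → G (d * ℓ))
    ∎
    where
    open ≡-Reasoning
    multiple : ∀ d → _ → 𝟙 ((ℓ * d) <ᵇ suc n) * G (ℓ * d) ≡ G (d * ℓ)
    multiple d (yes ℓd≤n) rewrite <ᵇ-true ℓd≤n = trans (+-identityʳ _) (cong G (*-comm ℓ d))
    multiple d (no ℓd≰n) rewrite <ᵇ-false ℓd≰n =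
      sym (trans (cong G (*-comm d ℓ)) (G-vanishes (ℓ * d) (≤-trans (n≤1+n n) (≮⇒≥ ℓd≰n))))

  -- dissections grouped by the size 3 + d ℓ of their root cell
  byRootCell : ℕ → ℕ → ℕ
  byRootCell n m = 𝟙 (1 ≤ᵇ m) * ∑ (suc n) (λ d → segCount (suc n) (suc (d * ℓ)) (m ∸ 1))

  D≡oneₚ+byRootCell : ∀ n m → D n m ≡ oneₚ n m + byRootCell n m
  D≡oneₚ+byRootCell zero    zero    = refl
  D≡oneₚ+byRootCell zero    (suc m) = sym (trans (+-identityʳ _) (segCount-vanishes 1 1 m (s≤s z≤n)))
  D≡oneₚ+byRootCell (suc n) m = trans (Dcoef-root-cell n m) (cong (𝟙 (1 ≤ᵇ m) *_)
    (∑-periodic-sizes (suc n) (λ r → segCount (suc (suc n)) (suc r) (m ∸ 1))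
                      (λ r n+1≤r → segCount-vanishes (suc (suc n)) (suc r) (m ∸ 1) (s≤s n+1≤r))))

  first-identity : D ≈ₚ (oneₚ ⊕ Σz (λ d → mono (1 + d * ℓ) 1 ⊛ D ^ₚ (2 + d * ℓ)))
  first-identity n m = trans (D≡oneₚ+byRootCell n m) (cong (oneₚ n m +_) (sym
    (trans (sumTo≡∑ n _) (trans (∑-ext (suc n) (λ d → monomial-term d n m)) (∑-*ˡ (suc n) (𝟙 (1 ≤ᵇ m)) _)))))

  D⊖oneₚ≡byRootCell : ∀ n m → (D ⊖ oneₚ) n m ≡ byRootCell n m
  D⊖oneₚ≡byRootCell n m = trans (cong (_∸ oneₚ n m) (D≡oneₚ+byRootCell n m)) (m+n∸m≡n (oneₚ n m) (byRootCell n m))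

  z^ℓD^ℓ-coefficient : ∀ i j → (mono ℓ 0 ⊛ D ^ₚ ℓ) i j ≡ 𝟙 (1 ≤ᵇ i) * segCount i ℓ' j
  z^ℓD^ℓ-coefficient zero    j = mono⊛ ℓ 0 (D ^ₚ ℓ) zero j
  z^ℓD^ℓ-coefficient (suc i) j = trans (mono⊛ ℓ 0 (D ^ₚ ℓ) (suc i) j)
    (trans (cong (λ z → 𝟙 (ℓ <ᵇ suc (suc i)) * (1 * z)) (D^-coefficient ℓ' (suc i ∸ ℓ) j)) (fits (ℓ' <? suc i)))
    where
    fits : _ → 𝟙 (ℓ' <ᵇ suc i) * (1 * segCount (suc i ∸ ℓ + ℓ) ℓ' j) ≡ 1 * segCount (suc i) ℓ' j
    fits (yes ℓ'≤i) rewrite <ᵇ-true ℓ'≤i = trans (+-identityʳ _) (cong (λ z → 1 * segCount z ℓ' j) (m∸n+n≡m ℓ'≤i))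
    fits (no ℓ'≰i)  rewrite <ᵇ-false ℓ'≰i = sym (trans (cong (1 *_) (segCount-vanishes (suc i) ℓ' j (≮⇒≥ ℓ'≰i))) refl)

  z^ℓD^ℓ⊛[D⊖oneₚ] : ∀ n m → ((mono ℓ 0 ⊛ D ^ₚ ℓ) ⊛ (D ⊖ oneₚ)) n m
    ≡ ∑ n (λ i → ∑ (suc m) (λ j → segCount (suc i) ℓ' j * byRootCell (n ∸ suc i) (m ∸ j)))
  z^ℓD^ℓ⊛[D⊖oneₚ] n m = begin
      ((mono ℓ 0 ⊛ D ^ₚ ℓ) ⊛ (D ⊖ oneₚ)) n m
    ≡⟨ ⊛-∑ (mono ℓ 0 ⊛ D ^ₚ ℓ) (D ⊖ oneₚ) n m ⟩
      ∑ (suc n) (λ i → ∑ (suc m) (λ j → (mono ℓ 0 ⊛ D ^ₚ ℓ) i j * (D ⊖ oneₚ) (n ∸ i) (m ∸ j)))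
    ≡⟨ ∑-ext (suc n) (λ i → ∑-ext (suc m) (λ j →
         cong₂ _*_ (z^ℓD^ℓ-coefficient i j) (D⊖oneₚ≡byRootCell (n ∸ i) (m ∸ j)))) ⟩
      ∑ (suc n) (λ i → ∑ (suc m) (λ j → 𝟙 (1 ≤ᵇ i) * segCount i ℓ' j * byRootCell (n ∸ i) (m ∸ j)))
    ≡⟨ ∑-suc n _ ⟩
      ∑ (suc m) (λ _ → 0) + ∑ n (λ i → ∑ (suc m) (λ j → (segCount (suc i) ℓ' j + 0) * byRootCell (n ∸ suc i) (m ∸ j)))
    ≡⟨ cong₂ _+_ (∑-zero (suc m) (λ _ _ → refl))
                 (∑-ext n (λ i → ∑-ext (suc m) (λ j →
                    cong (_* byRootCell (n ∸ suc i) (m ∸ j)) (+-identityʳ (segCount (suc i) ℓ' j))))) ⟩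
      ∑ n (λ i → ∑ (suc m) (λ j → segCount (suc i) ℓ' j * byRootCell (n ∸ suc i) (m ∸ j)))
    ∎
    where open ≡-Reasoning

  byRootCell-shift : ∀ n i m j → i < n → j ≤ m →
    byRootCell (n ∸ suc i) (suc m ∸ j) ≡ ∑ n (λ d → segCount (n ∸ i) (suc (d * ℓ)) (m ∸ j))
  byRootCell-shift n i m j i<n j≤m = begin
      byRootCell (n ∸ suc i) (suc m ∸ j)
    ≡⟨ cong (byRootCell (n ∸ suc i)) (+-∸-assoc 1 j≤m) ⟩
      ∑ (suc (n ∸ suc i)) (λ d → segCount (suc (n ∸ suc i)) (suc (d * ℓ)) (m ∸ j)) + 0
    ≡⟨ +-identityʳ _ ⟩
      ∑ (suc (n ∸ suc i)) (λ d → segCount (suc (n ∸ suc i)) (suc (d * ℓ)) (m ∸ j))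
    ≡⟨ cong (λ z → ∑ z (λ d → segCount z (suc (d * ℓ)) (m ∸ j))) width ⟩
      ∑ (n ∸ i) (λ d → segCount (n ∸ i) (suc (d * ℓ)) (m ∸ j))
    ≡⟨ sym (∑-pad (n ∸ i) n (m∸n≤m n i) (λ d n∸i≤d _ → segCount-vanishes (n ∸ i) (suc (d * ℓ)) (m ∸ j)
         (s≤s (≤-trans (m∸n≤m (n ∸ i) 1) (≤-trans n∸i≤d (m≤m*n d ℓ)))))) ⟩
      ∑ n (λ d → segCount (n ∸ i) (suc (d * ℓ)) (m ∸ j))
    ∎
    where
    open ≡-Reasoning
    width : suc (n ∸ suc i) ≡ n ∸ i
    width = trans (cong suc (sym (pred[m∸n]≡m∸[1+n] n i))) (suc[n∸1]≡n (m<n⇒0<n∸m i<n))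

  -- the root cells with 3 + (d+1)ℓ vertices, d < n
  byRootCell-tail : ∀ n m → 𝟙 (1 ≤ᵇ m) * ∑ n (λ d → segCount (suc n) (suc (suc d * ℓ)) (m ∸ 1))
    ≡ ((mono ℓ 0 ⊛ D ^ₚ ℓ) ⊛ (D ⊖ oneₚ)) n m
  byRootCell-tail n zero =
    sym (trans (z^ℓD^ℓ⊛[D⊖oneₚ] n zero) (∑-zero n (λ i _ → ∑-zero 1 (λ j _ → *-zeroʳ (segCount (suc i) ℓ' j)))))
  byRootCell-tail n (suc m) = begin
      ∑ n (λ d → segCount (suc n) (suc (suc d * ℓ)) m) + 0
    ≡⟨ +-identityʳ _ ⟩
      ∑ n (λ d → segCount (suc n) (suc (suc d * ℓ)) m)
    ≡⟨ ∑-ext n (λ d → trans (cong (λ z → segCount (suc n) (suc z) m) (sym (+-suc ℓ' (d * ℓ))))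
                            (segCount-split ℓ' (suc (d * ℓ)) m (suc n))) ⟩
      ∑ n (λ d → ∑ n (λ i → ∑ (suc m) (λ j → term i j d)))
    ≡⟨ sym (∑-swap n n (λ i d → ∑ (suc m) (λ j → term i j d))) ⟩
      ∑ n (λ i → ∑ n (λ d → ∑ (suc m) (λ j → term i j d)))
    ≡⟨ ∑-ext n (λ i → sym (∑-swap (suc m) n (λ j d → term i j d))) ⟩
      ∑ n (λ i → ∑ (suc m) (λ j → ∑ n (λ d → term i j d)))
    ≡⟨ ∑-ext n (λ i → ∑-ext (suc m) (λ j →
         ∑-*ˡ n (segCount (suc i) ℓ' j) (λ d → segCount (n ∸ i) (suc (d * ℓ)) (m ∸ j)))) ⟩
      ∑ n (λ i → ∑ (suc m) (λ j → segCount (suc i) ℓ' j * ∑ n (λ d → segCount (n ∸ i) (suc (d * ℓ)) (m ∸ j))))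
    ≡⟨ ∑-cong n (λ i i<n → ∑-cong (suc m) (λ j j≤m →
         cong (segCount (suc i) ℓ' j *_) (sym (byRootCell-shift n i m j i<n (≤-pred j≤m))))) ⟩
      ∑ n (λ i → ∑ (suc m) (summand i))
    ≡⟨ ∑-ext n (λ i → sym (trans (cong (∑ (suc m) (summand i) +_) (last-summand i)) (+-identityʳ _))) ⟩
      ∑ n (λ i → ∑ (suc (suc m)) (summand i))
    ≡⟨ sym (z^ℓD^ℓ⊛[D⊖oneₚ] n (suc m)) ⟩
      ((mono ℓ 0 ⊛ D ^ₚ ℓ) ⊛ (D ⊖ oneₚ)) n (suc m)
    ∎
    where
    open ≡-Reasoning
    term : ℕ → ℕ → ℕ → ℕ
    term i j d = segCount (suc i) ℓ' j * segCount (suc n ∸ suc i) (suc (d * ℓ)) (m ∸ j)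
    summand : ℕ → ℕ → ℕ
    summand i j = segCount (suc i) ℓ' j * byRootCell (n ∸ suc i) (suc m ∸ j)
    last-summand : ∀ i → summand i (suc m) ≡ 0
    last-summand i = trans (cong (λ z → segCount (suc i) ℓ' (suc m) * byRootCell (n ∸ suc i) z) (n∸n≡0 m))
                           (*-zeroʳ (segCount (suc i) ℓ' (suc m)))

  second-identity : (D ⊖ oneₚ) ≈ₚ (mono 1 1 ⊛ D ^ₚ 2 ⊕ mono ℓ 0 ⊛ D ^ₚ ℓ ⊛ (D ⊖ oneₚ))
  second-identity n m = begin
      (D ⊖ oneₚ) n m
    ≡⟨ D⊖oneₚ≡byRootCell n m ⟩
      𝟙 (1 ≤ᵇ m) * ∑ (suc n) (λ d → segCount (suc n) (suc (d * ℓ)) (m ∸ 1))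
    ≡⟨ cong (𝟙 (1 ≤ᵇ m) *_) (∑-suc n (λ d → segCount (suc n) (suc (d * ℓ)) (m ∸ 1))) ⟩
      𝟙 (1 ≤ᵇ m) * (segCount (suc n) 1 (m ∸ 1) + ∑ n (λ d → segCount (suc n) (suc (suc d * ℓ)) (m ∸ 1)))
    ≡⟨ *-distribˡ-+ (𝟙 (1 ≤ᵇ m)) _ _ ⟩
      𝟙 (1 ≤ᵇ m) * segCount (suc n) 1 (m ∸ 1) + 𝟙 (1 ≤ᵇ m) * ∑ n (λ d → segCount (suc n) (suc (suc d * ℓ)) (m ∸ 1))
    ≡⟨ cong₂ _+_ (sym (monomial-term 0 n m)) (byRootCell-tail n m) ⟩
      (mono 1 1 ⊛ D ^ₚ 2 ⊕ mono ℓ 0 ⊛ D ^ₚ ℓ ⊛ (D ⊖ oneₚ)) n m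
    ∎
    where open ≡-Reasoning

proposition3p6 : (ℓ : ℕ) → 1 ≤ ℓ →
    (Dgf ℓ ≈ₚ (oneₚ ⊕ Σz (λ k → mono (1 + k * ℓ) 1 ⊛ Dgf ℓ ^ₚ (2 + k * ℓ))))
    × (Dgf ℓ ⊖ oneₚ ≈ₚ (mono 1 1 ⊛ Dgf ℓ ^ₚ 2 ⊕ mono ℓ 0 ⊛ Dgf ℓ ^ₚ ℓ ⊛ (Dgf ℓ ⊖ oneₚ)))
proposition3p6 (suc ℓ') _ = first-identity , second-identity
  where open Identities ℓ'
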